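{- Let $G$ be a graph, and suppose that $G$ has a positive rank divisor $D$ that partitions $V(G)$. Then $\mathrm{scw}(G)\leq \deg(D)$. In particular, if $\deg(D)=\mathrm{gon}(G)$, then $\mathrm{scw}(G)\leq \mathrm{gon}(G)$.
   Context: All graphs are finite connected multigraphs (multiple edges allowed, no loops). Divisors and gonality: a divisor on $G$ is a function $D:V(G)\to\mathbb{Z}$; its degree is $\deg(D)=\sum_v D(v)$; it is effective if $D(v)\geq 0$ for all $v$; its support $\mathrm{supp}(D)$ is $\{v: D(v)\neq 0\}$. Firing a vertex $v$ decreases $D(v)$ by the valence of $v$ and increases $D(w)$ by the number of edges between $v$ and $w$ for each $w\neq v$. Two divisors are equivalent if one is obtained from the other by a sequence of such firings. $D$ has positive rank if for every $v\in V(G)$ there is an effective divisor $D'$ equivalent to $D$ with $D'(v)\geq 1$. $\mathrm{gon}(G)$ is the minimum degree of a positive rank divisor. A positive rank divisor $D$ partitions $V(G)$ if for every pair of distinct effective divisors $D',D''$ equivalent to $D$ we have $\mathrm{supp}(D')\cap\mathrm{supp}(D'')=\emptyset$. Screewidth: a tree-cut decomposition of $G$ is a pair $(T,\mathcal{X})$ with $T$ a tree (vertices = nodes, edges = links) and $\mathcal{X}=\{X_b: b\in V(T)\}$ pairwise disjoint, possibly empty subsets of $V(G)$ (bags) with union $V(G)$. For a link $l$, $\mathrm{adh}(l)$ is the set of edges of $G$ with endpoints in bags $X_b,X_d$ where $b,d$ lie in different components of $T-l$; for a node $b$, $\mathrm{adh}(b)$ is the set of edges of $G$ with endpoints in bags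 $X_c,X_d$ where $c,d$ lie in different components of $T-b$. The width is $\max\{\max_l|\mathrm{adh}(l)|,\ \max_b(|X_b|+|\mathrm{adh}(b)|)\}$, and $\mathrm{scw}(G)$ is the minimum width over all tree-cut decompositions of $G$. -}

module Defs where

open import Data.Nat as ℕ using (ℕ; zero; suc; _≤_; _<?_; _⊔_)
open import Data.Integer as ℤ using (ℤ; +_; _-_)
open import Data.Fin using (Fin; toℕ; _≟_)
open import Data.List using (List; foldr; map)
open import Data.List.Base using (allFin)
open import Data.Bool using (Bool; true; false; _∧_; _∨_; not; if_then_else_; T)
open import Data.Product using (Σ; ∃; _×_; _,_)
open import Data.Sum using (_⊎_)
open import Relation.Nullary using (¬_; does)
open import Relation.Binary.PropositionalEquality using (_≡_)
open import Relation.Binary.Construct.Closure.ReflexiveTransitive using (Star)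

sumℕ : ∀ {n} → (Fin n → ℕ) → ℕ
sumℕ {n} f = foldr ℕ._+_ 0 (map f (allFin n))

sumℤ : ∀ {n} → (Fin n → ℤ) → ℤ
sumℤ {n} f = foldr ℤ._+_ (+ 0) (map f (allFin n))

maxℕ : ∀ {n} → (Fin n → ℕ) → ℕ
maxℕ {n} f = foldr _⊔_ 0 (map f (allFin n))

anyF : ∀ {n} → (Fin n → Bool) → Bool
anyF {n} p = foldr _∨_ false (map p (allFin n))

pairSum : ∀ {n} → (Fin n → Fin n → ℕ) → ℕ
pairSum f = sumℕ (λ u → sumℕ (λ v → if does (toℕ u <? toℕ v) then f u v else 0))

eqB : ∀ {n} → Fin n → Fin n → Bool
eqB x y = does (x ≟ y)

-- Finite connected multigraphs (multiple edges allowed, no loops).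
-- Vertices are Fin n; mult u v = number of edges between u and v.

record Graph : Set where
  field
    n         : ℕ
    mult      : Fin n → Fin n → ℕ
    mult-sym  : ∀ u v → mult u v ≡ mult v u
    no-loops  : ∀ v → mult v v ≡ 0
    nonempty  : 1 ≤ n
    connected : ∀ u v → Star (λ x y → 1 ≤ mult x y) u v

open Graph public

Divisor : Graph → Set
Divisor G = Fin (n G) → ℤ

deg : (G : Graph) → Divisor G → ℤ
deg G D = sumℤ D

valence : (G : Graph) → Fin (n G) → ℕ
valence G v = sumℕ (λ w → mult G v w)

fire : (G : Graph) → Fin (n G) → Divisor G → Divisor G
fire G v D w = if eqB w v then D w - + valence G v else D w ℤ.+ + mult G v w

FireStep : (G : Graph) → Divisor G → Divisor G → Set
FireStep G D D' = ∃ λ v → ∀ w → D' w ≡ fire G v D w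

Equiv : (G : Graph) → Divisor G → Divisor G → Set
Equiv G = Star (FireStep G)

Effective : (G : Graph) → Divisor G → Set
Effective G D = ∀ v → + 0 ℤ.≤ D v

PositiveRank : (G : Graph) → Divisor G → Set
PositiveRank G D = ∀ v → ∃ λ D' → Equiv G D D' × Effective G D' × + 1 ℤ.≤ D' v

Partitions : (G : Graph) → Divisor G → Set
Partitions G D = ∀ D' D'' → Equiv G D D' → Equiv G D D'' →
  Effective G D' → Effective G D'' → ¬ (∀ v → D' v ≡ D'' v) →
  ∀ v → D' v ≡ + 0 ⊎ D'' v ≡ + 0

IsGonality : Graph → ℤ → Set
IsGonality G g = (∃ λ D → PositiveRank G D × deg G D ≡ g)
               × (∀ D → PositiveRank G D → g ℤ.≤ deg G D)

-- Simple graphs on Fin t given by a Boolean adjacency; reachability by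
-- walks of length ≤ fuel (fuel = t suffices for t vertices).

reachB : ∀ {t} → (Fin t → Fin t → Bool) → ℕ → Fin t → Fin t → Bool
reachB adj zero x y = eqB x y
reachB adj (suc k) x y = reachB adj k x y ∨ anyF (λ z → reachB adj k x z ∧ adj z y)

-- Trees: nonempty, connected, and minimally connected (removing any
-- link disconnects its endpoints), i.e. connected and acyclic.
record Tree : Set where
  field
    t         : ℕ
    adj       : Fin t → Fin t → Bool
    adj-sym   : ∀ a b → adj a b ≡ adj b a
    adj-irr   : ∀ a → adj a a ≡ false
    nonempty  : 1 ≤ t
    connected : ∀ a b → T (reachB adj t a b)
    minimal   : ∀ a b → T (adj a b) →
      ¬ T (reachB (λ x y → adj x y ∧ not ((eqB x a ∧ eqB y b) ∨ (eqB x b ∧ eqB y a))) t a b)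

open Tree public

adjMinusLink : (τ : Tree) → Fin (t τ) → Fin (t τ) → Fin (t τ) → Fin (t τ) → Bool
adjMinusLink τ a b x y = adj τ x y ∧ not ((eqB x a ∧ eqB y b) ∨ (eqB x b ∧ eqB y a))

adjMinusNode : (τ : Tree) → Fin (t τ) → Fin (t τ) → Fin (t τ) → Bool
adjMinusNode τ b x y = adj τ x y ∧ not (eqB x b) ∧ not (eqB y b)

-- Tree-cut decomposition: a tree and a bag for every vertex of G
-- (bag v = the node whose bag X_b contains v; bags are thus pairwise
-- disjoint, possibly empty, with union V(G)).
record TreeCutDecomposition (G : Graph) : Set where
  field
    tree : Tree
    bag  : Fin (n G) → Fin (t tree)

open TreeCutDecomposition public

module _ {G : Graph} (𝒯 : TreeCutDecomposition G) where
  private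
    τ = tree 𝒯
    X = bag 𝒯

  bagSize : Fin (t τ) → ℕ
  bagSize b = sumℕ (λ v → if eqB (X v) b then 1 else 0)

  adhLink : Fin (t τ) → Fin (t τ) → ℕ
  adhLink a b = pairSum (λ u v →
    if not (reachB (adjMinusLink τ a b) (t τ) (X u) (X v)) then mult G u v else 0)

  adhNode : Fin (t τ) → ℕ
  adhNode b = pairSum (λ u v →
    if not (eqB (X u) b) ∧ not (eqB (X v) b)
           ∧ not (reachB (adjMinusNode τ b) (t τ) (X u) (X v))
    then mult G u v else 0)

  width : ℕ
  width = maxℕ (λ a → maxℕ (λ b → if adj τ a b then adhLink a b else 0))
        ⊔ maxℕ (λ b → bagSize b ℕ.+ adhNode b)

{-# OPTIONS --safe #-}
-- For every vertex x fix an effective divisor D⁺ x equivalent to D and positive at x. Because D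
-- partitions V(G), two effective divisors of the class whose supports meet coincide, so the
-- supports of the D⁺ x partition V(G) and serve as bags. Write D⁺ root = D⁺ x − Δ(height x).
-- Firing from D⁺ x the set where height x is maximal keeps the divisor effective, so by
-- disjointness of supports the result is the divisor of another bag, the parent of x; the range
-- of the height strictly drops along parents, so the parent relation is a tree. Every edge of G
-- joins a bag to itself or to a neighbouring bag, hence node adhesions vanish. A bag has at most
-- deg D vertices since D⁺ is at least 1 on it, and every edge from the bag of x to the bag of
-- its parent is counted by the chips D⁺ x loses in that firing, so link adhesions are at most
-- deg D too.
module Submission where
open import Defs
import Algebra.Properties.CommutativeMonoid.Sum as CommutativeMonoidSum
open import Data.Bool as Bool using (Bool; true; false; if_then_else_; T; not; _∧_; _∨_)
import Data.Bool.Properties as BoolP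
open import Data.Empty using (⊥; ⊥-elim)
open import Data.Fin using (Fin; zero; suc; toℕ; fromℕ<; _≟_)
open import Data.Fin.Subset using (Subset; _∈_; _⊂_; ∣_∣)
import Data.Fin.Subset.Properties as SubsetP
import Data.Fin.Properties as FinP
open import Data.Integer as ℤ using (ℤ; +_; -_; _-_; _+_; _*_; _≤_; _<_; +≤+)
import Data.Integer.Properties as ℤP
open import Data.Integer.Tactic.RingSolver using (solve-∀)
import Data.List as List
import Data.List.Extrema
import Data.List.Relation.Unary.All as All
open import Data.List.Membership.Propositional using (lose)
open import Data.List.Membership.Propositional.Properties using (∈-allFin)
import Data.List.Properties as ListP
open import Data.List.Relation.Unary.Any using (satisfied)
open import Data.List.Relation.Unary.Any.Properties using (any⁺; any⁻)
open import Data.Maybe using (Maybe; just; nothing; fromMaybe)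
import Data.Maybe as Maybe
open import Data.Nat as ℕ using (ℕ; zero; suc; z≤n; s≤s)
import Data.Nat.Properties as ℕP
open import Data.Product as Product using (Σ; ∃; _×_; _,_; proj₁; proj₂)
open import Data.Sum as Sum using (_⊎_; inj₁; inj₂)
open import Data.Unit using (tt)
import Data.Vec as Vec
import Data.Vec.Functional as Vector
import Data.Vec.Properties as VecP
open import Function using (id; _∘_; Equivalence; mk⇔)
open import Relation.Binary.Construct.Closure.ReflexiveTransitive using (Star; ε; _◅_; _◅◅_; map; reverse)
open import Relation.Binary.PropositionalEquality
open import Relation.Nullary using (Dec; yes; no; ¬_; does)
open import Relation.Nullary.Decidable using (dec-true; dec-false; does-⇔; T?; _→-dec_)

foldr-allFin : ∀ {A : Set} (_⊕_ : A → A → A) (e : A) {k} (f : Fin k → A) →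
  List.foldr _⊕_ e (List.map f (List.allFin k)) ≡ Vector.foldr _⊕_ e f
foldr-allFin {A} _⊕_ e f = trans (cong (List.foldr _⊕_ e) (ListP.map-tabulate id f)) (go f)
  where
  go : ∀ {k} (g : Fin k → A) → List.foldr _⊕_ e (List.tabulate g) ≡ Vector.foldr _⊕_ e g
  go {zero} g = refl
  go {suc k} g = cong (g zero ⊕_) (go (g ∘ suc))

module ℤΣ = CommutativeMonoidSum ℤP.+-0-commutativeMonoid

module ℕΣ = CommutativeMonoidSum ℕP.+-0-commutativeMonoid

open ℤΣ using (sum; sum-cong-≗; ∑-distrib-+; ∑-comm)

sumℤ≡sum : ∀ {k} (f : Fin k → ℤ) → sumℤ f ≡ sum f
sumℤ≡sum = foldr-allFin _+_ (+ 0)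

sumℕ≡sum : ∀ {k} (f : Fin k → ℕ) → sumℕ f ≡ ℕΣ.sum f
sumℕ≡sum = foldr-allFin ℕ._+_ 0

sum-zero : ∀ k → sum {k} (λ _ → + 0) ≡ + 0
sum-zero = ℤΣ.sum-replicate-zero

sum-neg : ∀ {k} (f : Fin k → ℤ) → sum (λ i → - f i) ≡ - sum f
sum-neg {zero} f = refl
sum-neg {suc k} f =
  trans (cong (_+_ (- f zero)) (sum-neg (f ∘ suc))) (sym (ℤP.neg-distrib-+ (f zero) _))

sum-minus : ∀ {k} (f g : Fin k → ℤ) → sum (λ i → f i - g i) ≡ sum f - sum g
sum-minus f g = trans (∑-distrib-+ f (λ i → - g i)) (cong (_+_ (sum f)) (sum-neg g))

sum-mono-≤ : ∀ {k} {f g : Fin k → ℤ} → (∀ i → f i ≤ g i) → sum f ≤ sum g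
sum-mono-≤ {zero} f≤g = ℤP.≤-refl
sum-mono-≤ {suc k} f≤g = ℤP.+-mono-≤ (f≤g zero) (sum-mono-≤ (f≤g ∘ suc))

sum-nonNeg : ∀ {k} {f : Fin k → ℤ} → (∀ i → + 0 ≤ f i) → + 0 ≤ sum f
sum-nonNeg {k} {f} 0≤f = subst (_≤ sum f) (sum-zero k) (sum-mono-≤ 0≤f)

≤-+-nonNeg : ∀ i {j} → + 0 ≤ j → i ≤ i + j
≤-+-nonNeg i {j} 0≤j = subst (_≤ i + j) (ℤP.+-identityʳ i) (ℤP.+-monoʳ-≤ i 0≤j)

≤-nonNeg-+ : ∀ {i} j → + 0 ≤ i → j ≤ i + j
≤-nonNeg-+ {i} j 0≤i = subst (j ≤_) (ℤP.+-comm j i) (≤-+-nonNeg j 0≤i)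

term≤sum : ∀ {k} {f : Fin k → ℤ} → (∀ i → + 0 ≤ f i) → ∀ j → f j ≤ sum f
term≤sum {suc k} {f} 0≤f zero = ≤-+-nonNeg (f zero) (sum-nonNeg (0≤f ∘ suc))
term≤sum {suc k} {f} 0≤f (suc j) =
  ℤP.≤-trans (term≤sum (0≤f ∘ suc) j) (≤-nonNeg-+ (sum (f ∘ suc)) (0≤f zero))

sum-indicator : ∀ {k} (j : Fin k) (c : ℤ) → sum (λ i → if eqB i j then c else + 0) ≡ c
sum-indicator {suc k} zero c = trans (cong (_+_ c) (sum-zero k)) (ℤP.+-identityʳ c)
sum-indicator {suc k} (suc j) c = trans (ℤP.+-identityˡ _) (sum-indicator j c)

+-sum : ∀ {k} (f : Fin k → ℕ) → + ℕΣ.sum f ≡ sum (+_ ∘ f)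
+-sum {zero} f = refl
+-sum {suc k} f = trans (ℤP.pos-+ (f zero) _) (cong (_+_ (+ f zero)) (+-sum (f ∘ suc)))

ℕsum-mono : ∀ {k} {f g : Fin k → ℕ} → (∀ i → f i ℕ.≤ g i) → ℕΣ.sum f ℕ.≤ ℕΣ.sum g
ℕsum-mono {zero} f≤g = z≤n
ℕsum-mono {suc k} f≤g = ℕP.+-mono-≤ (f≤g zero) (ℕsum-mono (f≤g ∘ suc))

ℕsum-zero : ∀ {k} {f : Fin k → ℕ} → (∀ i → f i ≡ 0) → ℕΣ.sum f ≡ 0
ℕsum-zero {zero} _ = refl
ℕsum-zero {suc k} f≡0 = cong₂ ℕ._+_ (f≡0 zero) (ℕsum-zero (f≡0 ∘ suc))

maxℕ-lub : ∀ {k} (f : Fin k → ℕ) {B} → (∀ i → f i ℕ.≤ B) → maxℕ f ℕ.≤ B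
maxℕ-lub f {B} f≤B = subst (ℕ._≤ B) (sym (foldr-allFin ℕ._⊔_ 0 f)) (lub f f≤B)
  where
  lub : ∀ {k} (f : Fin k → ℕ) → (∀ i → f i ℕ.≤ B) → Vector.foldr ℕ._⊔_ 0 f ℕ.≤ B
  lub {zero} f f≤B = z≤n
  lub {suc k} f f≤B = ℕP.⊔-lub (f≤B zero) (lub (f ∘ suc) (f≤B ∘ suc))

below : ∀ {k} → Fin k → Fin k → Bool
below u v = does (toℕ u ℕ.<? toℕ v)

pairSum≡ : ∀ {k} (f : Fin k → Fin k → ℕ) →
  pairSum f ≡ ℕΣ.sum (λ u → ℕΣ.sum (λ v → if below u v then f u v else 0))
pairSum≡ {k} f = trans (sumℕ≡sum (λ u → sumℕ (row u))) (ℕΣ.sum-cong-≗ (λ u → sumℕ≡sum (row u)))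
  where
  row : Fin k → Fin k → ℕ
  row u v = if below u v then f u v else 0

if-0 : ∀ c → (if c then 0 else 0) ≡ 0
if-0 true = refl
if-0 false = refl

if-mono : ∀ (c : Bool) {a b : ℕ} → a ℕ.≤ b → (if c then a else 0) ℕ.≤ (if c then b else 0)
if-mono true a≤b = a≤b
if-mono false _ = z≤n

pairSum-mono : ∀ {k} {f g : Fin k → Fin k → ℕ} → (∀ u v → f u v ℕ.≤ g u v) → pairSum f ℕ.≤ pairSum g
pairSum-mono {f = f} {g} f≤g = subst₂ ℕ._≤_ (sym (pairSum≡ f)) (sym (pairSum≡ g))
  (ℕsum-mono (λ u → ℕsum-mono (λ v → if-mono (below u v) (f≤g u v))))

pairSum-zero : ∀ {k} {f : Fin k → Fin k → ℕ} → (∀ u v → f u v ≡ 0) → pairSum f ≡ 0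
pairSum-zero {f = f} f≡0 = trans (pairSum≡ f) (ℕsum-zero (λ u → ℕsum-zero (λ v →
  trans (cong (λ m → if below u v then m else 0) (f≡0 u v)) (if-0 (below u v)))))

pairSum-symmetrised : ∀ {k} (g : Fin k → Fin k → ℕ) →
  pairSum (λ u v → g u v ℕ.+ g v u) ℕ.≤ ℕΣ.sum (λ u → ℕΣ.sum (λ v → g u v))
pairSum-symmetrised {k} g = begin
  pairSum (λ u v → g u v ℕ.+ g v u)
    ≡⟨ pairSum≡ (λ u v → g u v ℕ.+ g v u) ⟩
  ℕΣ.sum (λ u → ℕΣ.sum (λ v → if below u v then g u v ℕ.+ g v u else 0))
    ≡⟨ ℕΣ.sum-cong-≗ (λ u → trans (ℕΣ.sum-cong-≗ (λ v → if-+ (below u v) (g u v) (g v u)))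
                                  (ℕΣ.∑-distrib-+ (lower u) (λ v → upper v u))) ⟩
  ℕΣ.sum (λ u → ℕΣ.sum (lower u) ℕ.+ ℕΣ.sum (λ v → upper v u))
    ≡⟨ ℕΣ.∑-distrib-+ (λ u → ℕΣ.sum (lower u)) (λ u → ℕΣ.sum (λ v → upper v u)) ⟩
  ℕΣ.sum (λ u → ℕΣ.sum (lower u)) ℕ.+ ℕΣ.sum (λ u → ℕΣ.sum (λ v → upper v u))
    ≡⟨ cong (ℕΣ.sum (λ u → ℕΣ.sum (lower u)) ℕ.+_) (ℕΣ.∑-comm (λ u v → upper v u)) ⟩
  ℕΣ.sum (λ u → ℕΣ.sum (lower u)) ℕ.+ ℕΣ.sum (λ v → ℕΣ.sum (upper v))
    ≡⟨ ℕΣ.∑-distrib-+ (λ u → ℕΣ.sum (lower u)) (λ u → ℕΣ.sum (upper u)) ⟨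
  ℕΣ.sum (λ u → ℕΣ.sum (lower u) ℕ.+ ℕΣ.sum (upper u))
    ≡⟨ ℕΣ.sum-cong-≗ (λ u → ℕΣ.∑-distrib-+ (lower u) (upper u)) ⟨
  ℕΣ.sum (λ u → ℕΣ.sum (λ v → lower u v ℕ.+ upper u v))
    ≤⟨ ℕsum-mono (λ u → ℕsum-mono (λ v → at-most-once u v)) ⟩
  ℕΣ.sum (λ u → ℕΣ.sum (λ v → g u v))
    ∎
  where
  open ℕP.≤-Reasoning
  lower upper : Fin k → Fin k → ℕ
  lower u v = if below u v then g u v else 0
  upper u v = if below v u then g u v else 0
  if-+ : ∀ (c : Bool) a b → (if c then a ℕ.+ b else 0) ≡ (if c then a else 0) ℕ.+ (if c then b else 0)
  if-+ true a b = refl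
  if-+ false a b = refl
  at-most-once : ∀ u v → lower u v ℕ.+ upper u v ℕ.≤ g u v
  at-most-once u v = byCases (toℕ u ℕ.<? toℕ v) (toℕ v ℕ.<? toℕ u)
    where
    byCases : (u<v? : Dec (toℕ u ℕ.< toℕ v)) (v<u? : Dec (toℕ v ℕ.< toℕ u)) →
      (if does u<v? then g u v else 0) ℕ.+ (if does v<u? then g u v else 0) ℕ.≤ g u v
    byCases (yes u<v) (yes v<u) = ⊥-elim (ℕP.<-asym u<v v<u)
    byCases (yes _)   (no _)    = ℕP.≤-reflexive (ℕP.+-identityʳ (g u v))
    byCases (no _)    (yes _)   = ℕP.≤-refl
    byCases (no _)    (no _)    = z≤n

true≢false : ¬ true ≡ false
true≢false ()

bool-cases : ∀ (b : Bool) {P : Set} → (b ≡ true → P) → (b ≡ false → P) → P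
bool-cases true  t f = t refl
bool-cases false t f = f refl

∧-not-true : ∀ {a b} → (a ∧ not b) ≡ true → a ≡ true × b ≡ false
∧-not-true {true} {false} refl = refl , refl

∧-not-false : ∀ {a b} → (a ∧ not b) ≡ false → a ≡ true → b ≡ true
∧-not-false {true} {true} _ refl = refl

if-¬T : ∀ {c} k → ¬ T c → (if c then k else 0) ≡ 0
if-¬T {false} k _ = refl
if-¬T {true} k ¬c = ⊥-elim (¬c tt)

if-≤ : ∀ c k → (if c then k else 0) ℕ.≤ k
if-≤ true k = ℕP.≤-refl
if-≤ false k = z≤n

if-T-≤ : ∀ c {k B} → (T c → k ℕ.≤ B) → (if c then k else 0) ℕ.≤ B
if-T-≤ true k≤B = k≤B tt
if-T-≤ false _ = z≤n

T-not⇒¬T : ∀ {b} → T (not b) → T b → ⊥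
T-not⇒¬T {false} _ ()

¬T⇒T-not : ∀ {b} → ¬ T b → T (not b)
¬T⇒T-not {false} _ = tt
¬T⇒T-not {true} ¬b = ⊥-elim (¬b tt)

¬[A→B]⇒A×¬B : ∀ {A B : Set} → Dec A → ¬ (A → B) → A × ¬ B
¬[A→B]⇒A×¬B (yes a) ¬A→B = a , λ b → ¬A→B (λ _ → b)
¬[A→B]⇒A×¬B (no ¬a) ¬A→B = ⊥-elim (¬A→B (λ a → ⊥-elim (¬a a)))

eqB-refl : ∀ {k} (i : Fin k) → eqB i i ≡ true
eqB-refl i = dec-true (i ≟ i) refl

eqB-≢ : ∀ {k} {i j : Fin k} → ¬ i ≡ j → eqB i j ≡ false
eqB-≢ {i = i} {j} = dec-false (i ≟ j)

eqB⇒≡ : ∀ {k} {i j : Fin k} → eqB i j ≡ true → i ≡ j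
eqB⇒≡ {i = i} {j} e with i ≟ j
... | yes i≡j = i≡j

eqB⇒≢ : ∀ {k} {i j : Fin k} → eqB i j ≡ false → ¬ i ≡ j
eqB⇒≢ {i = i} {j} e with i ≟ j
... | no i≢j = i≢j

eqB-sym : ∀ {k} (a b : Fin k) → eqB a b ≡ eqB b a
eqB-sym a b = does-⇔ (mk⇔ sym sym) (a ≟ b) (b ≟ a)

T-eqB⁺ : ∀ {k} {a b : Fin k} → a ≡ b → T (eqB a b)
T-eqB⁺ {a = a} refl = Equivalence.from BoolP.T-≡ (eqB-refl a)

T-not-eqB⁺ : ∀ {k} {a b : Fin k} → ¬ a ≡ b → T (not (eqB a b))
T-not-eqB⁺ a≢b = Equivalence.from BoolP.T-not-≡ (eqB-≢ a≢b)

T-eqB⁻ : ∀ {k} {a b : Fin k} → T (eqB a b) → a ≡ b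
T-eqB⁻ a≡b = eqB⇒≡ (Equivalence.to BoolP.T-≡ a≡b)

T-not-eqB⁻ : ∀ {k} {a b : Fin k} → T (not (eqB a b)) → ¬ a ≡ b
T-not-eqB⁻ a≢b = eqB⇒≢ (Equivalence.to BoolP.T-not-≡ a≢b)

link-endpoints : ∀ {k} (a b p q : Fin k) → T ((eqB p a ∧ eqB q b) ∨ (eqB p b ∧ eqB q a)) →
  (p ≡ a × q ≡ b) ⊎ (p ≡ b × q ≡ a)
link-endpoints a b p q pq with Equivalence.to (BoolP.T-∨ {eqB p a ∧ eqB q b}) pq
... | inj₁ ab = inj₁ (Product.map T-eqB⁻ T-eqB⁻ (Equivalence.to BoolP.T-∧ ab))
... | inj₂ ba = inj₂ (Product.map T-eqB⁻ T-eqB⁻ (Equivalence.to BoolP.T-∧ ba))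

anyF-intro : ∀ {k} (p : Fin k → Bool) z → T (p z) → T (anyF p)
anyF-intro p z pz = any⁺ p (lose (∈-allFin z) pz)

anyF-elim : ∀ {k} (p : Fin k → Bool) → T (anyF p) → ∃ λ z → T (p z)
anyF-elim {k} p any-p = satisfied (any⁻ p (List.allFin k) any-p)

first : ∀ {k} → (Fin k → Bool) → Maybe (Fin k)
first {zero} P = nothing
first {suc k} P = if P zero then just zero else Maybe.map suc (first (P ∘ suc))

first-complete : ∀ {k} (P : Fin k → Bool) i → P i ≡ true → ∃ λ j → first P ≡ just j × P j ≡ true
first-complete {suc k} P i Pi with P zero in P0
... | true = zero , refl , P0
first-complete {suc k} P zero Pi | false with trans (sym P0) Pi
... | ()
first-complete {suc k} P (suc i) Pi | false with first-complete (P ∘ suc) i Pi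
... | j , first≡j , Pj = suc j , cong (Maybe.map suc) first≡j , Pj

first-cong : ∀ {k} {P Q : Fin k → Bool} → (∀ i → P i ≡ Q i) → first P ≡ first Q
first-cong {zero} P≗Q = refl
first-cong {suc k} {P} {Q} P≗Q rewrite P≗Q zero =
  cong (λ x → if Q zero then just zero else Maybe.map suc x) (first-cong (P≗Q ∘ suc))

positive? : ℤ → Bool
positive? a = does (+ 1 ℤ.≤? a)

positive?-sound : ∀ {a} → positive? a ≡ true → + 1 ≤ a
positive?-sound {a} a>0 with + 1 ℤ.≤? a
... | yes 1≤a = 1≤a

positive?-complete : ∀ {a} → + 1 ≤ a → positive? a ≡ true
positive?-complete {a} = dec-true (+ 1 ℤ.≤? a)

positive⇒≢0 : ∀ {a} → + 1 ≤ a → ¬ a ≡ + 0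
positive⇒≢0 (+≤+ ()) refl

nonNeg∧¬positive⇒0 : ∀ {a} → + 0 ≤ a → ¬ (+ 1 ≤ a) → a ≡ + 0
nonNeg∧¬positive⇒0 {+ zero} _ _ = refl
nonNeg∧¬positive⇒0 {+ suc _} _ a≯0 = ⊥-elim (a≯0 (+≤+ (s≤s z≤n)))

x+y≡x⇒y≡0 : ∀ x y → x + y ≡ x → y ≡ + 0
x+y≡x⇒y≡0 x y x+y≡x = trans (regroup x y) (trans (cong (λ a → a - x) x+y≡x) (ℤP.+-inverseʳ x))
  where
  regroup : ∀ x y → y ≡ x + y - x
  regroup = solve-∀

-‿cancelˡ : ∀ x a b → x - a ≡ x - b → a ≡ b
-‿cancelˡ x a b x-a≡x-b = trans (twice-neg x a) (trans (cong (_-_ x) x-a≡x-b) (sym (twice-neg x b)))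
  where
  twice-neg : ∀ x a → a ≡ x - (x - a)
  twice-neg = solve-∀

<⇒1≤- : ∀ {i j} → i < j → + 1 ≤ j - i
<⇒1≤- {i} {j} i<j = subst (_≤ j - i) (cancel i) (ℤP.+-monoˡ-≤ (- i) (ℤP.i<j⇒suc[i]≤j i<j))
  where
  cancel : ∀ i → + 1 + i - i ≡ + 1
  cancel = solve-∀

<⇒≤-1 : ∀ {i j} → i < j → i ≤ j - + 1
<⇒≤-1 {i} {j} i<j = subst (_≤ j - + 1) (cancel i) (ℤP.+-monoˡ-≤ (- + 1) (ℤP.i<j⇒suc[i]≤j i<j))
  where
  cancel : ∀ i → + 1 + i - + 1 ≡ i
  cancel = solve-∀

∣∣-mono-< : ∀ {i j} → + 0 ≤ i → i < j → ℤ.∣ i ∣ ℕ.< ℤ.∣ j ∣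
∣∣-mono-< {i} {j} 0≤i i<j =
  ℤP.drop‿+<+ (subst₂ _<_ (sym (ℤP.0≤i⇒+∣i∣≡i 0≤i)) (sym (ℤP.0≤i⇒+∣i∣≡i 0≤j)) i<j)
  where
  0≤j : + 0 ≤ j
  0≤j = ℤP.<⇒≤ (ℤP.≤-<-trans 0≤i i<j)

¬1≤n⇒n≡0 : ∀ {m} → ¬ 1 ℕ.≤ m → m ≡ 0
¬1≤n⇒n≡0 ¬1≤m = ℕP.n<1⇒n≡0 (ℕP.≰⇒> ¬1≤m)

module ℤExtrema = Data.List.Extrema ℤP.≤-totalOrder

𝟙 : ∀ {k} → (Fin k → Bool) → Fin k → ℤ
𝟙 A u = if A u then + 1 else + 0

𝟙-true : ∀ {k} (A : Fin k → Bool) {u} → A u ≡ true → 𝟙 A u ≡ + 1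
𝟙-true A Au = cong (λ b → if b then + 1 else + 0) Au

𝟙-false : ∀ {k} (A : Fin k → Bool) {u} → A u ≡ false → 𝟙 A u ≡ + 0
𝟙-false A Au = cong (λ b → if b then + 1 else + 0) Au

module Reachability {t : ℕ} (adj : Fin t → Fin t → Bool) where

  Edge : Fin t → Fin t → Set
  Edge a b = T (adj a b)

  Reach : ℕ → Fin t → Fin t → Set
  Reach k x y = T (reachB adj k x y)

  reach-refl : ∀ k x → Reach k x x
  reach-refl zero x = Equivalence.from BoolP.T-≡ (eqB-refl x)
  reach-refl (suc k) x = Equivalence.from BoolP.T-∨ (inj₁ (reach-refl k x))

  reach-zero : ∀ {x y} → Reach 0 x y → x ≡ y
  reach-zero {x} {y} r = eqB⇒≡ (Equivalence.to BoolP.T-≡ r)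

  reach-suc : ∀ k {x y} → Reach k x y → Reach (suc k) x y
  reach-suc k r = Equivalence.from BoolP.T-∨ (inj₁ r)

  reach-step : ∀ k {x z y} → Reach k x z → Edge z y → Reach (suc k) x y
  reach-step k {x} {z} {y} r e = Equivalence.from BoolP.T-∨
    (inj₂ (anyF-intro (λ w → reachB adj k x w ∧ adj w y) z (Equivalence.from BoolP.T-∧ (r , e))))

  reach-suc⁻¹ : ∀ k {x y} → Reach (suc k) x y → Reach k x y ⊎ ∃ λ z → Reach k x z × Edge z y
  reach-suc⁻¹ k {x} {y} r with Equivalence.to (BoolP.T-∨ {reachB adj k x y}) r
  ... | inj₁ r′ = inj₁ r′
  ... | inj₂ via with anyF-elim (λ w → reachB adj k x w ∧ adj w y) via
  ...   | z , rz∧e = inj₂ (z , Equivalence.to BoolP.T-∧ rz∧e)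

  reach-+ : ∀ i {k x y} → Reach k x y → Reach (i ℕ.+ k) x y
  reach-+ zero r = r
  reach-+ (suc i) {k} r = reach-suc (i ℕ.+ k) (reach-+ i r)

  reach-mono : ∀ {k k′} → k ℕ.≤ k′ → ∀ {x y} → Reach k x y → Reach k′ x y
  reach-mono {k} {k′} k≤k′ r = subst (λ j → Reach j _ _) (ℕP.m∸n+n≡m k≤k′) (reach-+ (k′ ℕ.∸ k) r)

  reach-prepend : ∀ k {x a y} → Edge x a → Reach k a y → Reach (suc k) x y
  reach-prepend zero {x} {a} {y} e r = reach-step 0 {x} {x} {y} (reach-refl 0 x) (subst (Edge x) (reach-zero {a} {y} r) e)
  reach-prepend (suc k) e r with reach-suc⁻¹ k r
  ... | inj₁ r′ = reach-suc (suc k) (reach-prepend k e r′)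
  ... | inj₂ (z , r′ , e′) = reach-step (suc k) (reach-prepend k e r′) e′

  Star⇒reach : ∀ {x y} → Star Edge x y → ∃ λ k → Reach k x y
  Star⇒reach {x} ε = 0 , reach-refl 0 x
  Star⇒reach (e ◅ path) with Star⇒reach path
  ... | k , r = suc k , reach-prepend k e r

  reach⇒Star : ∀ k {x y} → Reach k x y → Star Edge x y
  reach⇒Star zero r = subst (Star Edge _) (reach-zero r) ε
  reach⇒Star (suc k) r with reach-suc⁻¹ k r
  ... | inj₁ r′ = reach⇒Star k r′
  ... | inj₂ (z , r′ , e) = reach⇒Star k r′ ◅◅ (e ◅ ε)

  -- The sets reached within k steps grow with k; once two consecutive ones agree they stay
  -- put, and as every strict increase adds a vertex this happens within t steps.
  module Saturation (x : Fin t) where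

    reached : ℕ → Subset t
    reached k = Vec.tabulate (reachB adj k x)

    ∈-reached⁺ : ∀ k {y} → Reach k x y → y ∈ reached k
    ∈-reached⁺ k {y} r =
      VecP.lookup⇒[]= y (reached k) (trans (VecP.lookup∘tabulate (reachB adj k x) y) (Equivalence.to BoolP.T-≡ r))

    ∈-reached⁻ : ∀ k {y} → y ∈ reached k → Reach k x y
    ∈-reached⁻ k {y} y∈ =
      Equivalence.from BoolP.T-≡ (trans (sym (VecP.lookup∘tabulate (reachB adj k x) y)) (VecP.[]=⇒lookup y∈))

    Stable : ℕ → Set
    Stable k = ∀ y → Reach (suc k) x y → Reach k x y

    stable-at? : ∀ k y → Dec (Reach (suc k) x y → Reach k x y)
    stable-at? k y = T? (reachB adj (suc k) x y) →-dec T? (reachB adj k x y)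

    unstable⇒grows : ∀ k → ¬ Stable k → reached k ⊂ reached (suc k)
    unstable⇒grows k unstable with FinP.¬∀⟶∃¬ t _ (stable-at? k) unstable
    ... | y , ¬stable-at-y with ¬[A→B]⇒A×¬B (T? (reachB adj (suc k) x y)) ¬stable-at-y
    ...   | new , ¬old = (λ {y′} y′∈ → ∈-reached⁺ (suc k) (reach-suc k {x} {y′} (∈-reached⁻ k y′∈)))
                       , y , ∈-reached⁺ (suc k) new , ¬old ∘ ∈-reached⁻ k

    stable-or-large : ∀ k → (∃ λ j → j ℕ.< k × Stable j) ⊎ k ℕ.≤ ∣ reached k ∣
    stable-or-large zero = inj₂ z≤n
    stable-or-large (suc k) with stable-or-large k | FinP.all? (stable-at? k)
    ... | inj₁ (j , j<k , stable) | _ = inj₁ (j , ℕP.m<n⇒m<1+n j<k , stable)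
    ... | inj₂ _ | yes stable = inj₁ (k , ℕP.n<1+n k , stable)
    ... | inj₂ k≤∣R∣ | no unstable =
      inj₂ (ℕP.≤-<-trans k≤∣R∣ (SubsetP.p⊂q⇒∣p∣<∣q∣ (unstable⇒grows k unstable)))

    stable-within-t : ∃ λ j → j ℕ.≤ t × Stable j
    stable-within-t with stable-or-large (suc t)
    ... | inj₁ (j , j<1+t , stable) = j , ℕP.≤-pred j<1+t , stable
    ... | inj₂ 1+t≤∣R∣ =
      ⊥-elim (ℕP.<-irrefl refl (ℕP.<-≤-trans 1+t≤∣R∣ (SubsetP.∣p∣≤n (reached (suc t)))))

    stable-forever : ∀ {j} → Stable j → ∀ i {y} → Reach (i ℕ.+ j) x y → Reach j x y
    stable-forever stable zero r = r
    stable-forever {j} stable (suc i) r with reach-suc⁻¹ (i ℕ.+ j) r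
    ... | inj₁ r′ = stable-forever stable i r′
    ... | inj₂ (z , r′ , e) = stable _ (reach-step j (stable-forever stable i r′) e)

    reach-within-t : ∀ k {y} → Reach k x y → Reach t x y
    reach-within-t k r with stable-within-t
    ... | j , j≤t , stable = reach-mono j≤t (stable-forever stable k (reach-mono (ℕP.m≤m+n k j) r))

  Star⇒reach-t : ∀ {x y} → Star Edge x y → Reach t x y
  Star⇒reach-t {x} path with Star⇒reach path
  ... | k , r = Saturation.reach-within-t x k r

module ParentPointerTree {t : ℕ} (1≤t : 1 ℕ.≤ t) (parent : Fin t → Fin t) (root : Fin t)
                         (parent-root : parent root ≡ root) (depth : Fin t → ℕ)
                         (depth-parent : ∀ {x} → ¬ x ≡ root → depth (parent x) ℕ.< depth x) where

  linked : Fin t → Fin t → Bool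
  linked a b = not (eqB a b) ∧ (eqB (parent a) b ∨ eqB (parent b) a)

  open Reachability linked using (Edge; Star⇒reach-t)

  linked-sym : ∀ a b → linked a b ≡ linked b a
  linked-sym a b = cong₂ _∧_ (cong not (eqB-sym a b)) (BoolP.∨-comm (eqB (parent a) b) (eqB (parent b) a))

  linked-irrefl : ∀ a → linked a a ≡ false
  linked-irrefl a rewrite eqB-refl a = refl

  linked⁺ : ∀ {a b} → parent a ≡ b → ¬ a ≡ b → Edge a b
  linked⁺ pa≡b a≢b =
    Equivalence.from BoolP.T-∧ (T-not-eqB⁺ a≢b , Equivalence.from BoolP.T-∨ (inj₁ (T-eqB⁺ pa≡b)))

  linked⁻ : ∀ {a b} → Edge a b → ¬ a ≡ b × (parent a ≡ b ⊎ parent b ≡ a)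
  linked⁻ {a} {b} ab with Equivalence.to (BoolP.T-∧ {not (eqB a b)}) ab
  ... | a≢b , link with Equivalence.to (BoolP.T-∨ {eqB (parent a) b}) link
  ...   | inj₁ pa≡b = T-not-eqB⁻ a≢b , inj₁ (T-eqB⁻ pa≡b)
  ...   | inj₂ pb≡a = T-not-eqB⁻ a≢b , inj₂ (T-eqB⁻ pb≡a)

  Edge-sym : ∀ {a b} → Edge a b → Edge b a
  Edge-sym {a} {b} = subst T (linked-sym a b)

  parent≢ : ∀ {x} → ¬ x ≡ root → ¬ x ≡ parent x
  parent≢ x≢root x≡px = ℕP.<-irrefl (cong depth (sym x≡px)) (depth-parent x≢root)

  path-to-root : ∀ x → Star Edge x root
  path-to-root x = descend (suc (depth x)) x (ℕP.n<1+n (depth x))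
    where
    descend : ∀ fuel x → depth x ℕ.< fuel → Star Edge x root
    descend (suc fuel) x depth<fuel with x ≟ root
    ... | yes refl = ε
    ... | no x≢root = linked⁺ refl (parent≢ x≢root)
                      ◅ descend fuel (parent x) (ℕP.<-≤-trans (depth-parent x≢root) (ℕP.≤-pred depth<fuel))

  connected-linked : ∀ a b → T (reachB linked t a b)
  connected-linked a b = Star⇒reach-t (path-to-root a ◅◅ reverse Edge-sym (path-to-root b))

  cutLink : Fin t → Fin t → Fin t → Fin t → Bool
  cutLink a b x y = linked x y ∧ not ((eqB x a ∧ eqB y b) ∨ (eqB x b ∧ eqB y a))

  cutLink-swap : ∀ a b x y → cutLink a b x y ≡ cutLink b a x y
  cutLink-swap a b x y = cong (λ q → linked x y ∧ not q) (BoolP.∨-comm (eqB x a ∧ eqB y b) (eqB x b ∧ eqB y a))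

  cutLink-sym : ∀ a b x y → cutLink a b x y ≡ cutLink a b y x
  cutLink-sym a b x y rewrite BoolP.∧-comm (eqB y a) (eqB x b) | BoolP.∧-comm (eqB y b) (eqB x a) =
    cong₂ (λ p q → p ∧ not q) (linked-sym x y) (BoolP.∨-comm (eqB x a ∧ eqB y b) (eqB x b ∧ eqB y a))

  ancestor : ℕ → Fin t → Fin t
  ancestor zero y = y
  ancestor (suc j) y = ancestor j (parent y)

  Descendant : Fin t → Fin t → Set
  Descendant c y = ∃ λ j → ancestor j y ≡ c

  depth-parent-≤ : ∀ y → depth (parent y) ℕ.≤ depth y
  depth-parent-≤ y with y ≟ root
  ... | yes refl = ℕP.≤-reflexive (cong depth parent-root)
  ... | no y≢root = ℕP.<⇒≤ (depth-parent y≢root)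

  depth-ancestor : ∀ j y → depth (ancestor j y) ℕ.≤ depth y
  depth-ancestor zero y = ℕP.≤-refl
  depth-ancestor (suc j) y = ℕP.≤-trans (depth-ancestor j (parent y)) (depth-parent-≤ y)

  CutEdge : Fin t → Fin t → Fin t → Set
  CutEdge c x y = T (cutLink c (parent c) x y)

  descendant-step : ∀ {c z y} → Descendant c z → CutEdge c z y → Descendant c y
  descendant-step {c} {z} {y} (j , zj≡c) cut with Equivalence.to (BoolP.T-∧ {linked z y}) cut
  ... | zy , not-cut with linked⁻ zy
  ...   | _ , inj₂ py≡z = suc j , trans (cong (ancestor j) py≡z) zj≡c
  ...   | _ , inj₁ pz≡y with j
  ...     | suc j′ = j′ , trans (cong (ancestor j′) (sym pz≡y)) zj≡c
  ...     | zero = ⊥-elim (T-not⇒¬T not-cut (Equivalence.from BoolP.T-∨ (inj₁ (Equivalence.from BoolP.T-∧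
                       (T-eqB⁺ zj≡c , T-eqB⁺ (trans (sym pz≡y) (cong parent zj≡c)))))))

  -- A walk from c avoiding the link to parent c stays among the descendants of c, and
  -- parent c is not one of them because depth decreases along parents.
  descendants-closed : ∀ {c z y} → Descendant c z → Star (CutEdge c) z y → Descendant c y
  descendants-closed desc ε = desc
  descendants-closed desc (cut ◅ path) = descendants-closed (descendant-step desc cut) path

  no-cut-path : ∀ {c} → ¬ c ≡ parent c → ¬ Star (CutEdge c) c (parent c)
  no-cut-path {c} c≢pc path with descendants-closed (0 , refl) path
  ... | j , pc-j≡c = ℕP.<-irrefl refl (begin-strict
      depth c                     ≡⟨ cong depth pc-j≡c ⟨
      depth (ancestor j (parent c)) ≤⟨ depth-ancestor j (parent c) ⟩
      depth (parent c)            <⟨ depth-parent c≢root ⟩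
      depth c                     ∎)
    where
    open ℕP.≤-Reasoning
    c≢root : ¬ c ≡ root
    c≢root refl = c≢pc (sym parent-root)

  minimal-linked : ∀ a b → T (linked a b) → ¬ T (reachB (cutLink a b) t a b)
  minimal-linked a b ab r with linked⁻ ab
  ... | a≢b , inj₁ refl = no-cut-path a≢b (Reachability.reach⇒Star (cutLink a b) t {a} {b} r)
  ... | a≢b , inj₂ refl = no-cut-path (a≢b ∘ sym)
    (map (λ {x} {y} → subst T (cutLink-swap a b x y))
         (reverse (λ {x} {y} → subst T (cutLink-sym a b x y)) (Reachability.reach⇒Star (cutLink a b) t {a} {b} r)))

  parentTree : Tree
  parentTree = record
    { t = t ; adj = linked ; adj-sym = linked-sym ; adj-irr = linked-irrefl ; nonempty = 1≤t
    ; connected = connected-linked ; minimal = minimal-linked }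

module Laplacian (G : Graph) where

  V : Set
  V = Fin (n G)

  μ : V → V → ℤ
  μ u v = + mult G u v

  μ-sym : ∀ u v → μ u v ≡ μ v u
  μ-sym u v = cong +_ (mult-sym G u v)

  Δ : (V → ℤ) → V → ℤ
  Δ f w = sum (λ u → μ w u * (f w - f u))

  δ : V → V → ℤ
  δ v = 𝟙 (λ u → eqB u v)

  Δ-cong : ∀ {f g} → (∀ u → f u ≡ g u) → ∀ w → Δ f w ≡ Δ g w
  Δ-cong f≗g w = sum-cong-≗ (λ u → cong₂ (λ a b → μ w u * (a - b)) (f≗g w) (f≗g u))

  Δ-+ : ∀ f g w → Δ (λ u → f u + g u) w ≡ Δ f w + Δ g w
  Δ-+ f g w = trans (sum-cong-≗ (λ u → distrib (μ w u) (f w) (f u) (g w) (g u)))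
                    (∑-distrib-+ (λ u → μ w u * (f w - f u)) (λ u → μ w u * (g w - g u)))
    where
    distrib : ∀ a b c d e → a * ((b + d) - (c + e)) ≡ a * (b - c) + a * (d - e)
    distrib = solve-∀

  Δ-neg : ∀ f w → Δ (λ u → - f u) w ≡ - Δ f w
  Δ-neg f w = trans (sum-cong-≗ (λ u → distrib (μ w u) (f w) (f u))) (sum-neg (λ u → μ w u * (f w - f u)))
    where
    distrib : ∀ a b c → a * ((- b) - (- c)) ≡ - (a * (b - c))
    distrib = solve-∀

  Δ-minus : ∀ f g w → Δ (λ u → f u - g u) w ≡ Δ f w - Δ g w
  Δ-minus f g w = trans (Δ-+ f (λ u → - g u) w) (cong (_+_ (Δ f w)) (Δ-neg g w))

  Δ-const : ∀ c w → Δ (λ _ → c) w ≡ + 0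
  Δ-const c w = trans (sum-cong-≗ (λ u → vanish (μ w u) c)) (sum-zero (n G))
    where
    vanish : ∀ a c → a * (c - c) ≡ + 0
    vanish = solve-∀

  sum-Δ : ∀ f → sum (Δ f) ≡ + 0
  sum-Δ f = begin
    sum (Δ f)
      ≡⟨ sum-cong-≗ (λ w → trans (sum-cong-≗ (antisym w)) (sum-minus (X w) (λ u → X u w))) ⟩
    sum (λ w → sum (X w) - sum (λ u → X u w))
      ≡⟨ sum-minus (λ w → sum (X w)) (λ w → sum (λ u → X u w)) ⟩
    sum (λ w → sum (X w)) - sum (λ w → sum (λ u → X u w))
      ≡⟨ cong (λ s → sum (λ w → sum (X w)) - s) (∑-comm (λ w u → X u w)) ⟩
    sum (λ w → sum (X w)) - sum (λ w → sum (X w))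
      ≡⟨ ℤP.+-inverseʳ (sum (λ w → sum (X w))) ⟩
    + 0
      ∎
    where
    open ≡-Reasoning
    X : V → V → ℤ
    X w u = μ w u * f w
    antisym : ∀ w u → μ w u * (f w - f u) ≡ X w u - X u w
    antisym w u = trans (distrib (μ w u) (f w) (f u)) (cong (λ a → X w u - a * f u) (μ-sym w u))
      where
      distrib : ∀ a b c → a * (b - c) ≡ a * b - a * c
      distrib = solve-∀

  degree-Δ : ∀ D f → sum (λ w → D w - Δ f w) ≡ sum D
  degree-Δ D f = trans (sum-minus D (Δ f)) (trans (cong (_-_ (sum D)) (sum-Δ f)) (ℤP.+-identityʳ _))

  valence≡sum : ∀ v → + valence G v ≡ sum (μ v)
  valence≡sum v = trans (cong +_ (sumℕ≡sum (mult G v))) (+-sum (mult G v))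

  Δ-δ-self : ∀ v → Δ (δ v) v ≡ + valence G v
  Δ-δ-self v = trans (sum-cong-≗ term) (sym (valence≡sum v))
    where
    term : ∀ u → μ v u * (δ v v - δ v u) ≡ μ v u
    term u rewrite eqB-refl v with u ≟ v
    ... | yes refl = trans (ℤP.*-zeroʳ (μ u u)) (cong +_ (sym (no-loops G u)))
    ... | no _ = ℤP.*-identityʳ (μ v u)

  Δ-δ-other : ∀ {v w} → ¬ w ≡ v → Δ (δ v) w ≡ - μ v w
  Δ-δ-other {v} {w} w≢v =
    trans (sum-cong-≗ term) (trans (sum-indicator v (- μ w v)) (cong -_ (μ-sym w v)))
    where
    term : ∀ u → μ w u * (δ v w - δ v u) ≡ (if eqB u v then - μ w v else + 0)
    term u rewrite eqB-≢ w≢v with u ≟ v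
    ... | yes refl = trans (sym (ℤP.neg-distribʳ-* (μ w u) (+ 1))) (cong -_ (ℤP.*-identityʳ (μ w u)))
    ... | no _ = ℤP.*-zeroʳ (μ w u)

  fire-Δ : ∀ v D w → fire G v D w ≡ D w - Δ (δ v) w
  fire-Δ v D w = byCases (w ≟ v)
    where
    byCases : (w≟v : Dec (w ≡ v)) →
      (if does w≟v then D w - + valence G v else D w + μ v w) ≡ D w - Δ (δ v) w
    byCases (yes refl) = cong (_-_ (D w)) (sym (Δ-δ-self w))
    byCases (no w≢v) = cong (_+_ (D w)) (trans (sym (ℤP.neg-involutive (μ v w))) (cong -_ (sym (Δ-δ-other w≢v))))

  _-Δ_ : Divisor G → (V → ℤ) → Divisor G
  (D -Δ φ) w = D w - Δ φ w

  -Δ-zero : ∀ D → D ≗ D -Δ (λ _ → + 0)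
  -Δ-zero D w = sym (trans (cong (_-_ (D w)) (Δ-const (+ 0) w)) (ℤP.+-identityʳ (D w)))

  -Δ-+ : ∀ D φ ψ → (D -Δ φ) -Δ ψ ≗ D -Δ (λ u → φ u + ψ u)
  -Δ-+ D φ ψ w = trans (assoc (D w) (Δ φ w) (Δ ψ w)) (cong (_-_ (D w)) (sym (Δ-+ φ ψ w)))
    where
    assoc : ∀ a b c → a - b - c ≡ a - (b + c)
    assoc = solve-∀

  fire-step : ∀ {D D₁ D'} v φ → (∀ w → D₁ w ≡ fire G v D w) → D' ≗ D₁ -Δ φ →
    D' ≗ D -Δ (λ u → δ v u + φ u)
  fire-step {D} v φ D₁≗ D'≗ w =
    trans (D'≗ w) (trans (cong (λ a → a - Δ φ w) (trans (D₁≗ w) (fire-Δ v D w))) (-Δ-+ D (δ v) φ w))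

  equiv⇒potential : ∀ {D D'} → Equiv G D D' → ∃ λ φ → D' ≗ D -Δ φ
  equiv⇒potential {D} ε = (λ _ → + 0) , -Δ-zero D
  equiv⇒potential {D} ((v , D₁≗) ◅ D₁~D') with equiv⇒potential D₁~D'
  ... | φ , D'≗ = (λ u → δ v u + φ u) , fire-step {D} v φ D₁≗ D'≗

  fire-selected : ∀ {k} (A : Fin k → Bool) (vs : Fin k → V) E →
    Σ (Divisor G) λ E' → Equiv G E E' × E' ≗ E -Δ (λ u → sum (λ i → if A i then δ (vs i) u else + 0))
  fire-selected {zero} A vs E = E , ε , -Δ-zero E
  fire-selected {suc k} A vs E with A zero
  ... | true with fire-selected (A ∘ suc) (vs ∘ suc) (fire G (vs zero) E)
  ...   | E' , E₁~E' , E'≗ = E' , (vs zero , λ _ → refl) ◅ E₁~E' , fire-step {E} (vs zero) _ (λ _ → refl) E'≗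
  fire-selected {suc k} A vs E | false with fire-selected (A ∘ suc) (vs ∘ suc) E
  ...   | E' , E~E' , E'≗ = E' , E~E' , λ w → trans (E'≗ w) (cong (_-_ (E w)) (Δ-cong (λ u → sym (ℤP.+-identityˡ
            (sum (λ i → if A (suc i) then δ (vs (suc i)) u else + 0)))) w))

  selected-indicator : ∀ (A : V → Bool) u → sum (λ i → if A i then δ i u else + 0) ≡ 𝟙 A u
  selected-indicator A u = trans (sum-cong-≗ term) (sum-indicator u (𝟙 A u))
    where
    term : ∀ i → (if A i then δ i u else + 0) ≡ (if eqB i u then 𝟙 A u else + 0)
    term i with u ≟ i
    ... | yes refl rewrite eqB-refl u = refl
    ... | no u≢i rewrite eqB-≢ (u≢i ∘ sym) with A i
    ...   | true = refl
    ...   | false = refl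

  fireSet : ∀ (A : V → Bool) E → Σ (Divisor G) λ E' → Equiv G E E' × E' ≗ E -Δ 𝟙 A
  fireSet A E with fire-selected A id E
  ... | E' , E~E' , E'≗ = E' , E~E' , λ w → trans (E'≗ w) (cong (_-_ (E w)) (Δ-cong (selected-indicator A) w))

  v₀ : V
  v₀ = fromℕ< (nonempty G)

  argmax : (V → ℤ) → V
  argmax f = ℤExtrema.argmax f v₀ (List.allFin (n G))

  max : (V → ℤ) → ℤ
  max f = f (argmax f)

  ≤-max : ∀ f w → f w ≤ max f
  ≤-max f w = All.lookup (ℤExtrema.f[xs]≤f[argmax] v₀ (List.allFin (n G))) (∈-allFin w)

  argmin : (V → ℤ) → V
  argmin f = ℤExtrema.argmin f v₀ (List.allFin (n G))

  min : (V → ℤ) → ℤ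
  min f = f (argmin f)

  min-≤ : ∀ f w → min f ≤ f w
  min-≤ f w = All.lookup (ℤExtrema.f[argmin]≤f[xs] v₀ (List.allFin (n G))) (∈-allFin w)

  maxSet : (V → ℤ) → V → Bool
  maxSet f u = does (f u ℤ.≟ max f)

  maxSet-argmax : ∀ f → maxSet f (argmax f) ≡ true
  maxSet-argmax f = dec-true (max f ℤ.≟ max f) refl

  maxSet-true : ∀ f {u} → maxSet f u ≡ true → f u ≡ max f
  maxSet-true f {u} fu≡max with f u ℤ.≟ max f
  ... | yes fu≡max = fu≡max

  maxSet-false : ∀ f {u} → maxSet f u ≡ false → f u < max f
  maxSet-false f {u} fu≢max with f u ℤ.≟ max f
  ... | no fu≢max = ℤP.≤∧≢⇒< (≤-max f u) fu≢max

  maxSet-complete : ∀ f {u} → f u ≡ max f → maxSet f u ≡ true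
  maxSet-complete f {u} = dec-true (f u ℤ.≟ max f)

  crossing : ∀ (S : V → Bool) {a b} → S a ≡ true → S b ≡ false →
    ∃ λ x → ∃ λ y → S x ≡ true × S y ≡ false × 1 ℕ.≤ mult G x y
  crossing S {a} {b} = walk (connected G a b)
    where
    walk : ∀ {a b} → Star (λ x y → 1 ℕ.≤ mult G x y) a b → S a ≡ true → S b ≡ false →
      ∃ λ x → ∃ λ y → S x ≡ true × S y ≡ false × 1 ℕ.≤ mult G x y
    walk ε Sa Sb with trans (sym Sa) Sb
    ... | ()
    walk {a} (_◅_ {j = a'} aa' a'~b) Sa Sb with S a' in Sa'
    ... | true = walk a'~b Sa' Sb
    ... | false = a , a' , Sa , Sa' , aa'

  μ*-nonNeg : ∀ u v {a} → + 0 ≤ a → + 0 ≤ μ u v * a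
  μ*-nonNeg u v {a} 0≤a = subst (_≤ μ u v * a) (ℤP.*-zeroʳ (μ u v)) (ℤP.*-monoˡ-≤-nonNeg (μ u v) 0≤a)

  Δ-mono : ∀ f g u → (∀ v → f u - f v ≤ g u - g v) → Δ f u ≤ Δ g u
  Δ-mono f g u f≤g = sum-mono-≤ (λ v → ℤP.*-monoˡ-≤-nonNeg (μ u v) (f≤g v))

  Δ-at-max-positive : ∀ h {x y} → maxSet h x ≡ true → maxSet h y ≡ false → 1 ℕ.≤ mult G x y →
    + 1 ≤ Δ h x
  Δ-at-max-positive h {x} {y} hx hy xy = begin
    + 1                   ≤⟨ +≤+ xy ⟩
    μ x y                 ≡⟨ ℤP.*-identityʳ (μ x y) ⟨
    μ x y * + 1           ≤⟨ ℤP.*-monoˡ-≤-nonNeg (μ x y) (<⇒1≤- hy<hx) ⟩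
    μ x y * (h x - h y)   ≤⟨ term≤sum nonNeg y ⟩
    Δ h x                 ∎
    where
    open ℤP.≤-Reasoning
    hy<hx : h y < h x
    hy<hx = subst (h y <_) (sym (maxSet-true h hx)) (maxSet-false h hy)
    nonNeg : ∀ v → + 0 ≤ μ x v * (h x - h v)
    nonNeg v = μ*-nonNeg x v (ℤP.i≤j⇒0≤j-i (subst (h v ≤_) (sym (maxSet-true h hx)) (≤-max h v)))

  harmonic⇒constant : ∀ h → (∀ w → Δ h w ≡ + 0) → ∀ w → h w ≡ max h
  harmonic⇒constant h Δh≡0 w with maxSet h w in hw
  ... | true = maxSet-true h hw
  ... | false with crossing (maxSet h) (maxSet-argmax h) hw
  ...   | x , y , hx , hy , xy = ⊥-elim (positive⇒≢0 (Δ-at-max-positive h hx hy xy) (Δh≡0 x))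

  maxSet-proper : ∀ {E E'} f → E' ≗ E -Δ f → ¬ (E' ≗ E) → ∃ λ b → maxSet f b ≡ false
  maxSet-proper {E} {E'} f E'≗ E'≉E with FinP.any? (λ b → maxSet f b Bool.≟ false)
  ... | yes proper = proper
  ... | no ¬proper =
    ⊥-elim (E'≉E λ w → trans (E'≗ w) (trans (cong (_-_ (E w)) (Δ-vanishes w)) (ℤP.+-identityʳ (E w))))
    where
    constant : ∀ w → f w ≡ max f
    constant w with maxSet f w in fw
    ... | true = maxSet-true f fw
    ... | false = ⊥-elim (¬proper (w , fw))
    Δ-vanishes : ∀ w → Δ f w ≡ + 0
    Δ-vanishes w = trans (Δ-cong constant w) (Δ-const (max f) w)

  𝟙-nonNeg : ∀ (A : V → Bool) u → + 0 ≤ 𝟙 A u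
  𝟙-nonNeg A u with A u
  ... | true = +≤+ z≤n
  ... | false = +≤+ z≤n

  𝟙≤1 : ∀ (A : V → Bool) u → 𝟙 A u ≤ + 1
  𝟙≤1 A u with A u
  ... | true = +≤+ (s≤s z≤n)
  ... | false = +≤+ z≤n

  𝟙-mono : ∀ (A B : V → Bool) v → (A v ≡ true → B v ≡ true) → 𝟙 A v ≤ 𝟙 B v
  𝟙-mono A B v A⊆B with A v in Av
  ... | true rewrite A⊆B refl = ℤP.≤-refl
  ... | false = 𝟙-nonNeg B v

  edgesInto : (V → Bool) → V → ℤ
  edgesInto A u = sum (λ v → μ u v * 𝟙 A v)

  edgesOutOf : (V → Bool) → V → ℤ
  edgesOutOf A u = sum (λ v → μ u v * (+ 1 - 𝟙 A v))

  edgesInto-nonNeg : ∀ A u → + 0 ≤ edgesInto A u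
  edgesInto-nonNeg A u = sum-nonNeg (λ v → μ*-nonNeg u v (𝟙-nonNeg A v))

  edgeOutOf-nonNeg : ∀ A u v → + 0 ≤ μ u v * (+ 1 - 𝟙 A v)
  edgeOutOf-nonNeg A u v = μ*-nonNeg u v (ℤP.i≤j⇒0≤j-i (𝟙≤1 A v))

  edgesOutOf-nonNeg : ∀ A u → + 0 ≤ edgesOutOf A u
  edgesOutOf-nonNeg A u = sum-nonNeg (edgeOutOf-nonNeg A u)

  μ≤edgesInto : ∀ A u {v} → A v ≡ true → μ u v ≤ edgesInto A u
  μ≤edgesInto A u {v} Av = subst (_≤ edgesInto A u) eq (term≤sum (λ w → μ*-nonNeg u w (𝟙-nonNeg A w)) v)
    where
    eq : μ u v * 𝟙 A v ≡ μ u v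
    eq rewrite Av = ℤP.*-identityʳ (μ u v)

  μ≤edgesOutOf : ∀ A u {v} → A v ≡ false → μ u v ≤ edgesOutOf A u
  μ≤edgesOutOf A u {v} Av = subst (_≤ edgesOutOf A u) eq (term≤sum (edgeOutOf-nonNeg A u) v)
    where
    eq : μ u v * (+ 1 - 𝟙 A v) ≡ μ u v
    eq rewrite Av = ℤP.*-identityʳ (μ u v)

  Δ𝟙-outside : ∀ A {u} → A u ≡ false → Δ (𝟙 A) u ≡ - edgesInto A u
  Δ𝟙-outside A {u} Au = trans (sum-cong-≗ term) (sum-neg (λ v → μ u v * 𝟙 A v))
    where
    negate : ∀ a b → a * (+ 0 - b) ≡ - (a * b)
    negate = solve-∀
    term : ∀ v → μ u v * (𝟙 A u - 𝟙 A v) ≡ - (μ u v * 𝟙 A v)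
    term v rewrite Au = negate (μ u v) (𝟙 A v)

  Δ𝟙-inside : ∀ A {u} → A u ≡ true → Δ (𝟙 A) u ≡ edgesOutOf A u
  Δ𝟙-inside A {u} Au = sum-cong-≗ term
    where
    term : ∀ v → μ u v * (𝟙 A u - 𝟙 A v) ≡ μ u v * (+ 1 - 𝟙 A v)
    term v rewrite Au = refl

  fire-outside : ∀ E A {u} → A u ≡ false → (E -Δ 𝟙 A) u ≡ E u + edgesInto A u
  fire-outside E A {u} Au =
    trans (cong (_-_ (E u)) (Δ𝟙-outside A Au)) (cong (_+_ (E u)) (ℤP.neg-involutive (edgesInto A u)))

  fire-inside : ∀ E A {u} → A u ≡ true → (E -Δ 𝟙 A) u ≡ E u - edgesOutOf A u
  fire-inside E A {u} Au = cong (_-_ (E u)) (Δ𝟙-inside A Au)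

  fire-outside-≥ : ∀ E A {u} → A u ≡ false → E u ≤ (E -Δ 𝟙 A) u
  fire-outside-≥ E A {u} Au =
    subst (E u ≤_) (sym (fire-outside E A Au)) (≤-+-nonNeg (E u) (edgesInto-nonNeg A u))

  fire-inside-≤ : ∀ E A {u} → A u ≡ true → (E -Δ 𝟙 A) u ≤ E u
  fire-inside-≤ E A {u} Au = subst (_≤ E u) (sym (fire-inside E A Au))
    (subst (E u - edgesOutOf A u ≤_) (ℤP.+-identityʳ (E u))
           (ℤP.+-monoʳ-≤ (E u) (ℤP.neg-mono-≤ (edgesOutOf-nonNeg A u))))

  fire-across-edge : ∀ E A {x y} → A x ≡ true → A y ≡ false → 1 ℕ.≤ mult G x y →
    + 0 ≤ E y → + 1 ≤ (E -Δ 𝟙 A) y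
  fire-across-edge E A {x} {y} Ax Ay xy 0≤Ey = begin
    + 1                   ≤⟨ +≤+ xy ⟩
    μ x y                 ≡⟨ μ-sym x y ⟩
    μ y x                 ≤⟨ μ≤edgesInto A y Ax ⟩
    edgesInto A y         ≤⟨ ≤-nonNeg-+ (edgesInto A y) 0≤Ey ⟩
    E y + edgesInto A y   ≡⟨ fire-outside E A Ay ⟨
    (E -Δ 𝟙 A) y          ∎
    where open ℤP.≤-Reasoning

  Δ𝟙-maxSet≤Δ : ∀ f {u} → maxSet f u ≡ true → Δ (𝟙 (maxSet f)) u ≤ Δ f u
  Δ𝟙-maxSet≤Δ f {u} fu = Δ-mono (𝟙 (maxSet f)) f u term
    where
    term : ∀ v → 𝟙 (maxSet f) u - 𝟙 (maxSet f) v ≤ f u - f v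
    term v with maxSet f v in fv
    ... | true rewrite fu = ℤP.i≤j⇒0≤j-i (subst (f v ≤_) (sym (maxSet-true f fu)) (≤-max f v))
    ... | false rewrite fu = <⇒1≤- (subst (f v <_) (sym (maxSet-true f fu)) (maxSet-false f fv))

  fire-maxSet-effective : ∀ {E E'} f → E' ≗ E -Δ f → Effective G E → Effective G E' →
    Effective G (E -Δ 𝟙 (maxSet f))
  fire-maxSet-effective {E} {E'} f E'≗ E≥0 E'≥0 u = byCase (maxSet f u) refl
    where
    open ℤP.≤-Reasoning
    byCase : ∀ b → maxSet f u ≡ b → + 0 ≤ (E -Δ 𝟙 (maxSet f)) u
    byCase false fu = ℤP.≤-trans (E≥0 u) (fire-outside-≥ E (maxSet f) fu)
    byCase true fu = begin
      + 0                       ≤⟨ E'≥0 u ⟩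
      E' u                      ≡⟨ E'≗ u ⟩
      E u - Δ f u               ≤⟨ ℤP.+-monoʳ-≤ (E u) (ℤP.neg-mono-≤ (Δ𝟙-maxSet≤Δ f fu)) ⟩
      (E -Δ 𝟙 (maxSet f)) u     ∎

  fire-superset-≥ : ∀ E (A C : V → Bool) → (∀ u → A u ≡ true → C u ≡ true) →
    ∀ {v} → A v ≡ true → (E -Δ 𝟙 A) v ≤ (E -Δ 𝟙 C) v
  fire-superset-≥ E A C A⊆C {v} Av = ℤP.+-monoʳ-≤ (E v) (ℤP.neg-mono-≤ (Δ-mono (𝟙 C) (𝟙 A) v term))
    where
    term : ∀ x → 𝟙 C v - 𝟙 C x ≤ 𝟙 A v - 𝟙 A x
    term x rewrite Av | A⊆C v Av = ℤP.+-monoʳ-≤ (+ 1) (ℤP.neg-mono-≤ (𝟙-mono A C x (A⊆C x)))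

  edgesOutOf-shrinks : ∀ (A C : V → Bool) {x y} → (∀ u → A u ≡ true → C u ≡ true) →
    A x ≡ false → C x ≡ true → 1 ℕ.≤ mult G x y → + 1 ≤ edgesOutOf A y - edgesOutOf C y
  edgesOutOf-shrinks A C {x} {y} A⊆C Ax Cx xy = begin
    + 1                                         ≤⟨ +≤+ xy ⟩
    μ x y                                       ≡⟨ μ-sym x y ⟩
    μ y x                                       ≡⟨ gap-at-x ⟨
    gap x                                       ≤⟨ term≤sum gap-nonNeg x ⟩
    sum gap                                     ≡⟨ sum-cong-≗ regroup ⟩
    sum (λ v → out A v - out C v)               ≡⟨ sum-minus (out A) (out C) ⟩
    edgesOutOf A y - edgesOutOf C y             ∎
    where
    open ℤP.≤-Reasoning
    gap : V → ℤ
    gap v = μ y v * (𝟙 C v - 𝟙 A v)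
    gap-nonNeg : ∀ v → + 0 ≤ gap v
    gap-nonNeg v = μ*-nonNeg y v (ℤP.i≤j⇒0≤j-i (𝟙-mono A C v (A⊆C v)))
    gap-at-x : gap x ≡ μ y x
    gap-at-x rewrite Ax | Cx = ℤP.*-identityʳ (μ y x)
    out : (V → Bool) → V → ℤ
    out S v = μ y v * (+ 1 - 𝟙 S v)
    distrib : ∀ m a c → m * (c - a) ≡ m * (+ 1 - a) - m * (+ 1 - c)
    distrib = solve-∀
    regroup : ∀ v → gap v ≡ out A v - out C v
    regroup v = distrib (μ y v) (𝟙 A v) (𝟙 C v)

  -Δ-injective : ∀ E f g → E -Δ f ≗ E -Δ g → ∀ w → Δ f w ≡ Δ g w
  -Δ-injective E f g E-Δf≗E-Δg w = -‿cancelˡ (E w) (Δ f w) (Δ g w) (E-Δf≗E-Δg w)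

  same-Δ⇒shift : ∀ f g → (∀ w → Δ f w ≡ Δ g w) → ∃ λ K → ∀ w → g w ≡ f w - K
  same-Δ⇒shift f g Δf≗Δg = max difference , λ w → trans (rearrange (f w) (g w)) (cong (_-_ (f w)) (constant w))
    where
    difference : V → ℤ
    difference w = f w - g w
    constant : ∀ w → difference w ≡ max difference
    constant = harmonic⇒constant difference
      (λ w → trans (Δ-minus f g w) (ℤP.i≡j⇒i-j≡0 (Δf≗Δg w)))
    rearrange : ∀ a b → b ≡ a - (a - b)
    rearrange = solve-∀

  range : (V → ℤ) → ℕ
  range f = ℤ.∣ max f - min f ∣

  range-decreases : ∀ f g K → (∀ w → g w ≡ f w - 𝟙 (maxSet f) w - K) →
    ∀ {b} → maxSet f b ≡ false → range g ℕ.< range f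
  range-decreases f g K g≡ {b} fb =
    ∣∣-mono-< (ℤP.i≤j⇒0≤j-i (ℤP.≤-trans (min-≤ g v₀) (≤-max g v₀))) (ℤP.suc[i]≤j⇒i<j (begin
      + 1 + (max g - min g)
        ≤⟨ ℤP.+-monoʳ-≤ (+ 1) (ℤP.+-mono-≤ (upper (argmax g)) (ℤP.neg-mono-≤ (lower (argmin g)))) ⟩
      + 1 + ((max f - + 1 - K) - (min f - K))  ≡⟨ shrink (max f) (min f) K ⟩
      max f - min f                           ∎))
    where
    open ℤP.≤-Reasoning
    shrink : ∀ M m K → + 1 + ((M - + 1 - K) - (m - K)) ≡ M - m
    shrink = solve-∀
    drop-zero : ∀ a K → a - + 0 - K ≡ a - K
    drop-zero = solve-∀
    outside : ∀ {w} → maxSet f w ≡ false → g w ≡ f w - K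
    outside {w} fw = trans (g≡ w) (trans (cong (λ a → f w - a - K) (𝟙-false (maxSet f) fw)) (drop-zero (f w) K))
    inside : ∀ {w} → maxSet f w ≡ true → g w ≡ max f - + 1 - K
    inside {w} fw = trans (g≡ w) (cong₂ (λ a c → a - c - K) (maxSet-true f fw) (𝟙-true (maxSet f) fw))
    upper : ∀ w → g w ≤ max f - + 1 - K
    upper w = bool-cases (maxSet f w) (ℤP.≤-reflexive ∘ inside) λ fw → begin
      g w                ≡⟨ outside fw ⟩
      f w - K            ≤⟨ ℤP.+-monoˡ-≤ (- K) (<⇒≤-1 (maxSet-false f fw)) ⟩
      max f - + 1 - K    ∎
    lower : ∀ w → min f - K ≤ g w
    lower w = bool-cases (maxSet f w)
      (λ fw → begin
        min f - K         ≤⟨ ℤP.+-monoˡ-≤ (- K) (ℤP.≤-trans (min-≤ f b) (<⇒≤-1 (maxSet-false f fb))) ⟩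
        max f - + 1 - K   ≡⟨ inside fw ⟨
        g w               ∎)
      (λ fw → begin
        min f - K         ≤⟨ ℤP.+-monoˡ-≤ (- K) (min-≤ f w) ⟩
        f w - K           ≡⟨ outside fw ⟨
        g w               ∎)

  not-maxSet-of-negation : ∀ f g → (∀ w → g w ≡ - f w) → ∀ {b v} → maxSet f b ≡ false →
    maxSet f v ≡ true → maxSet g v ≡ false
  not-maxSet-of-negation f g g≡-f {b} {v} fb fv = bool-cases (maxSet g v) contradiction id
    where
    contradiction : maxSet g v ≡ true → maxSet g v ≡ false
    contradiction gv = ⊥-elim (ℤP.<⇒≱ (maxSet-false f fb) (begin
      max f   ≡⟨ maxSet-true f fv ⟨
      f v     ≤⟨ ℤP.neg-cancel-≤ (subst₂ _≤_ (g≡-f b) g≡-fv (≤-max g b)) ⟩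
      f b     ∎))
      where
      open ℤP.≤-Reasoning
      g≡-fv : max g ≡ - f v
      g≡-fv = trans (sym (maxSet-true g gv)) (g≡-f v)

  maxSet-after-firing : ∀ f g (B : V → Bool) K → (∀ w → g w ≡ f w - 𝟙 B w - K) →
    (∀ w → B w ≡ false → maxSet f w ≡ true) → ∀ {b} → B b ≡ false → ∀ w → maxSet g w ≡ not (B w)
  maxSet-after-firing f g B K g≡ cover {b} Bb w = bool-cases (B w)
    (λ Bw → trans (dec-false (g w ℤ.≟ max g) (λ gw≡max → ℤP.<⇒≢ (inside-below Bw) (trans gw≡max max-g)))
                  (sym (cong not Bw)))
    (λ Bw → trans (maxSet-complete g (trans (outside Bw) (sym max-g))) (sym (cong not Bw)))
    where
    open ℤP.≤-Reasoning
    drop-zero : ∀ a K → a - + 0 - K ≡ a - K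
    drop-zero = solve-∀
    outside : ∀ {w} → B w ≡ false → g w ≡ max f - K
    outside {w} Bw = trans (g≡ w) (trans (cong (λ a → f w - a - K) (𝟙-false B Bw))
      (trans (drop-zero (f w) K) (cong (_- K) (maxSet-true f (cover w Bw)))))
    inside-below : ∀ {w} → B w ≡ true → g w < max f - K
    inside-below {w} Bw = ℤP.suc[i]≤j⇒i<j (begin
      + 1 + g w                  ≡⟨ cong (_+_ (+ 1)) (trans (g≡ w) (cong (λ a → f w - a - K) (𝟙-true B Bw))) ⟩
      + 1 + (f w - + 1 - K)      ≡⟨ cancel (f w) K ⟩
      f w - K                    ≤⟨ ℤP.+-monoˡ-≤ (- K) (≤-max f w) ⟩
      max f - K                  ∎)
      where
      cancel : ∀ a K → + 1 + (a - + 1 - K) ≡ a - K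
      cancel = solve-∀
    max-g : max g ≡ max f - K
    max-g = ℤP.≤-antisym
      (bool-cases (B (argmax g)) (ℤP.<⇒≤ ∘ inside-below) (ℤP.≤-reflexive ∘ outside))
      (subst (_≤ max g) (outside Bb) (≤-max g b))

  𝟙-complement : ∀ (B : V → Bool) u → 𝟙 (not ∘ B) u ≡ + 1 - 𝟙 B u
  𝟙-complement B u with B u
  ... | true = refl
  ... | false = refl

  fire-complement : ∀ E (B : V → Bool) → (E -Δ 𝟙 B) -Δ 𝟙 (not ∘ B) ≗ E
  fire-complement E B w = begin
    (E w - Δ (𝟙 B) w) - Δ (𝟙 (not ∘ B)) w
      ≡⟨ cong (_-_ (E w - Δ (𝟙 B) w)) (Δ-cong (𝟙-complement B) w) ⟩
    (E w - Δ (𝟙 B) w) - Δ (λ u → + 1 - 𝟙 B u) w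
      ≡⟨ cong (_-_ (E w - Δ (𝟙 B) w)) (Δ-minus (λ _ → + 1) (𝟙 B) w) ⟩
    (E w - Δ (𝟙 B) w) - (Δ (λ _ → + 1) w - Δ (𝟙 B) w)
      ≡⟨ cong (λ a → (E w - Δ (𝟙 B) w) - (a - Δ (𝟙 B) w)) (Δ-const (+ 1) w) ⟩
    (E w - Δ (𝟙 B) w) - (+ 0 - Δ (𝟙 B) w)
      ≡⟨ cancel (E w) (Δ (𝟙 B) w) ⟩
    E w
      ∎
    where
    open ≡-Reasoning
    cancel : ∀ a b → (a - b) - (+ 0 - b) ≡ a
    cancel = solve-∀

module Partition (G : Graph) (D : Divisor G)
                 (positive : PositiveRank G D) (partitions : Partitions G D) where

  open Laplacian G public

  InClass : Divisor G → Set
  InClass F = Σ (Divisor G) λ E → Equiv G D E × E ≗ F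

  class-fireSet : ∀ {F} → InClass F → ∀ A → InClass (F -Δ 𝟙 A)
  class-fireSet {F} (E , D~E , E≗F) A with fireSet A E
  ... | E' , E~E' , E'≗ = E' , D~E ◅◅ E~E' , λ w → trans (E'≗ w) (cong (λ a → a - Δ (𝟙 A) w) (E≗F w))

  class-potential : ∀ {F} → InClass F → ∃ λ φ → F ≗ D -Δ φ
  class-potential (E , D~E , E≗F) with equiv⇒potential D~E
  ... | φ , E≗ = φ , λ w → trans (sym (E≗F w)) (E≗ w)

  overlap⇒≗ : ∀ {F F'} → InClass F → InClass F' → Effective G F → Effective G F' →
    ∀ z → + 1 ≤ F z → + 1 ≤ F' z → F ≗ F'
  overlap⇒≗ {F} {F'} (E , D~E , E≗F) (E' , D~E' , E'≗F') F≥0 F'≥0 z Fz>0 F'z>0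
    with FinP.all? (λ w → F w ℤ.≟ F' w)
  ... | yes F≗F' = F≗F'
  ... | no F≉F' with partitions E E' D~E D~E' (λ v → subst (+ 0 ≤_) (sym (E≗F v)) (F≥0 v))
                       (λ v → subst (+ 0 ≤_) (sym (E'≗F' v)) (F'≥0 v))
                       (λ E≗E' → F≉F' (λ w → trans (sym (E≗F w)) (trans (E≗E' w) (E'≗F' w)))) z
  ...   | inj₁ Ez≡0 = ⊥-elim (positive⇒≢0 Fz>0 (trans (sym (E≗F z)) Ez≡0))
  ...   | inj₂ E'z≡0 = ⊥-elim (positive⇒≢0 F'z>0 (trans (sym (E'≗F' z)) E'z≡0))

  D⁺ : V → Divisor G
  D⁺ x = proj₁ (positive x)

  D⁺-class : ∀ x → InClass (D⁺ x)
  D⁺-class x = D⁺ x , proj₁ (proj₂ (positive x)) , λ _ → refl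

  D⁺-effective : ∀ x → Effective G (D⁺ x)
  D⁺-effective x = proj₁ (proj₂ (proj₂ (positive x)))

  D⁺-positive : ∀ x → + 1 ≤ D⁺ x x
  D⁺-positive x = proj₂ (proj₂ (proj₂ (positive x)))

  potential : V → V → ℤ
  potential x = proj₁ (class-potential (D⁺-class x))

  D⁺≗D-Δpotential : ∀ x → D⁺ x ≗ D -Δ potential x
  D⁺≗D-Δpotential x = proj₂ (class-potential (D⁺-class x))

  D⁺-unique : ∀ {F} → InClass F → Effective G F → ∀ z → + 1 ≤ F z → D⁺ z ≗ F
  D⁺-unique F∈ F≥0 z = overlap⇒≗ (D⁺-class z) F∈ (D⁺-effective z) F≥0 z (D⁺-positive z)

  D⁺-positive⇒≗ : ∀ {x y} → + 1 ≤ D⁺ y x → D⁺ x ≗ D⁺ y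
  D⁺-positive⇒≗ {x} {y} = D⁺-unique (D⁺-class y) (D⁺-effective y) x

  -- rep x is a canonical name for the effective divisor of the class that is positive at x.
  rep : V → V
  rep x = fromMaybe x (first (λ y → positive? (D⁺ y x)))

  D⁺-rep-positive : ∀ x → + 1 ≤ D⁺ (rep x) x
  D⁺-rep-positive x with first-complete (λ y → positive? (D⁺ y x)) x (positive?-complete (D⁺-positive x))
  ... | j , first≡j , Dj>0 rewrite first≡j = positive?-sound Dj>0

  D⁺-rep : ∀ x → D⁺ (rep x) ≗ D⁺ x
  D⁺-rep x w = sym (D⁺-positive⇒≗ (D⁺-rep-positive x) w)

  D⁺-positive-transfer : ∀ {x y z} → D⁺ x ≗ D⁺ y → + 1 ≤ D⁺ z x → + 1 ≤ D⁺ z y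
  D⁺-positive-transfer {x} {y} x≗y Dzx>0 =
    subst (+ 1 ≤_) (trans (sym (x≗y y)) (D⁺-positive⇒≗ Dzx>0 y)) (D⁺-positive y)

  rep-cong : ∀ {x y} → D⁺ x ≗ D⁺ y → rep x ≡ rep y
  rep-cong {x} {y} x≗y with first-complete (λ z → positive? (D⁺ z x)) x (positive?-complete (D⁺-positive x))
  ... | j , first≡j , _ =
    trans (cong (fromMaybe x) first≡j) (cong (fromMaybe y) (sym (trans (sym (first-cong same)) first≡j)))
    where
    same : ∀ z → positive? (D⁺ z x) ≡ positive? (D⁺ z y)
    same z = does-⇔ (mk⇔ (D⁺-positive-transfer {x} {y} {z} x≗y) (D⁺-positive-transfer (sym ∘ x≗y)))
      (+ 1 ℤ.≤? D⁺ z x) (+ 1 ℤ.≤? D⁺ z y)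

  rep-idem : ∀ x → rep (rep x) ≡ rep x
  rep-idem x = rep-cong (D⁺-rep x)

  D⁺-rep-unique : ∀ {F} → InClass F → Effective G F → ∀ z → + 1 ≤ F z → D⁺ (rep z) ≗ F
  D⁺-rep-unique F∈ F≥0 z Fz>0 w = trans (D⁺-rep z w) (D⁺-unique F∈ F≥0 z Fz>0 w)

  record LegalFiring (E : Divisor G) (A : V → Bool) : Set where
    field
      inClass        : InClass E
      effective      : Effective G E
      fired-effective : Effective G (E -Δ 𝟙 A)
      inside         : V
      inside∈        : A inside ≡ true
      outside        : V
      outside∉       : A outside ≡ false

  module LegalFiringProperties {E A} (legal : LegalFiring E A) where
    open LegalFiring legal

    fired-inClass : InClass (E -Δ 𝟙 A)
    fired-inClass = class-fireSet inClass A

    fired≉ : ¬ (E -Δ 𝟙 A ≗ E)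
    fired≉ fired≗E with crossing A inside∈ outside∉
    ... | x , y , Ax , Ay , xy = positive⇒≢0 1≤edgesInto edgesInto≡0
      where
      1≤edgesInto : + 1 ≤ edgesInto A y
      1≤edgesInto = ℤP.≤-trans (+≤+ xy) (subst (_≤ edgesInto A y) (μ-sym y x) (μ≤edgesInto A y Ax))
      edgesInto≡0 : edgesInto A y ≡ + 0
      edgesInto≡0 = x+y≡x⇒y≡0 (E y) _ (trans (sym (fire-outside E A Ay)) (fired≗E y))

    supports-disjoint : ∀ u → + 1 ≤ (E -Δ 𝟙 A) u → + 1 ≤ E u → ⊥
    supports-disjoint u fired>0 E>0 = fired≉ (overlap⇒≗ fired-inClass inClass fired-effective effective u fired>0 E>0)

    vanishes-outside : ∀ {u} → A u ≡ false → E u ≡ + 0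
    vanishes-outside {u} Au with + 1 ℤ.≤? E u
    ... | yes Eu>0 = ⊥-elim (supports-disjoint u (ℤP.≤-trans Eu>0 (fire-outside-≥ E A Au)) Eu>0)
    ... | no Eu≯0 = nonNeg∧¬positive⇒0 (effective u) Eu≯0

    fired-vanishes-inside : ∀ {u} → A u ≡ true → (E -Δ 𝟙 A) u ≡ + 0
    fired-vanishes-inside {u} Au with + 1 ℤ.≤? (E -Δ 𝟙 A) u
    ... | yes fired>0 = ⊥-elim (supports-disjoint u fired>0 (ℤP.≤-trans fired>0 (fire-inside-≤ E A Au)))
    ... | no fired≯0 = nonNeg∧¬positive⇒0 (fired-effective u) fired≯0

    ≡edgesOutOf-inside : ∀ {u} → A u ≡ true → E u ≡ edgesOutOf A u
    ≡edgesOutOf-inside {u} Au =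
      ℤP.i-j≡0⇒i≡j (E u) (edgesOutOf A u) (trans (sym (fire-inside E A Au)) (fired-vanishes-inside Au))

    positive⇒inside : ∀ {u} → + 1 ≤ E u → A u ≡ true
    positive⇒inside {u} Eu>0 = bool-cases (A u) id (λ Au → ⊥-elim (positive⇒≢0 Eu>0 (vanishes-outside Au)))

    fired-positive⇒outside : ∀ {u} → + 1 ≤ (E -Δ 𝟙 A) u → A u ≡ false
    fired-positive⇒outside {u} fired>0 =
      bool-cases (A u) (λ Au → ⊥-elim (positive⇒≢0 fired>0 (fired-vanishes-inside Au))) id

  maxSet-legal : ∀ {E E'} f → InClass E → Effective G E → Effective G E' → E' ≗ E -Δ f → ¬ (E' ≗ E) →
    LegalFiring E (maxSet f)
  maxSet-legal {E} {E'} f E∈ E≥0 E'≥0 E'≗ E'≉E = record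
    { inClass = E∈ ; effective = E≥0 ; fired-effective = fire-maxSet-effective f E'≗ E≥0 E'≥0
    ; inside = argmax f ; inside∈ = maxSet-argmax f
    ; outside = proj₁ (maxSet-proper f E'≗ E'≉E) ; outside∉ = proj₂ (maxSet-proper f E'≗ E'≉E) }

  legal-⊆⇒⊇ : ∀ {E A C} → LegalFiring E A → LegalFiring E C → (∀ u → A u ≡ true → C u ≡ true) →
    ∀ u → C u ≡ true → A u ≡ true
  legal-⊆⇒⊇ {E} {A} {C} legalA legalC A⊆C u Cu =
    bool-cases (A u) id λ Au → ⊥-elim (noCrossing (crossing X (Xu Au) X-inside))
    where
    module LA = LegalFiringProperties legalA
    module LC = LegalFiringProperties legalC
    X : V → Bool
    X v = C v ∧ not (A v)
    Xu : A u ≡ false → X u ≡ true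
    Xu Au rewrite Cu | Au = refl
    X-inside : X (LegalFiring.inside legalA) ≡ false
    X-inside rewrite LegalFiring.inside∈ legalA = BoolP.∧-zeroʳ _
    noCrossing : (∃ λ x → ∃ λ y → X x ≡ true × X y ≡ false × 1 ℕ.≤ mult G x y) → ⊥
    noCrossing (x , y , Xx , Xy , xy) = bool-cases (C y) Cy-true Cy-false
      where
      Cx : C x ≡ true
      Cx = proj₁ (∧-not-true Xx)
      Ax : A x ≡ false
      Ax = proj₂ (∧-not-true Xx)
      Ex≡edgesOutOf : E x ≡ edgesOutOf C x
      Ex≡edgesOutOf = LC.≡edgesOutOf-inside Cx
      Cy-false : C y ≡ false → ⊥
      Cy-false Cy = positive⇒≢0 (ℤP.≤-trans (+≤+ xy) (μ≤edgesOutOf C x Cy))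
        (trans (sym Ex≡edgesOutOf) (LA.vanishes-outside Ax))
      Cy-true : C y ≡ true → ⊥
      Cy-true Cy = positive⇒≢0 (edgesOutOf-shrinks A C A⊆C Ax Cx xy)
        (ℤP.i≡j⇒i-j≡0 (trans (sym (LA.≡edgesOutOf-inside (∧-not-false Xy Cy))) (LC.≡edgesOutOf-inside Cy)))

  legal-unique : ∀ {E A B} → LegalFiring E A → LegalFiring E B → ∀ {w} → A w ≡ false → B w ≡ false →
    ∀ u → A u ≡ B u
  legal-unique {E} {A} {B} legalA legalB {w} Aw Bw u =
    trans (BoolP.⇔→≡ (mk⇔ (A⊆C u) (legal-⊆⇒⊇ legalA legalC A⊆C u)))
          (sym (BoolP.⇔→≡ (mk⇔ (B⊆C u) (legal-⊆⇒⊇ legalB legalC B⊆C u))))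
    where
    C : V → Bool
    C v = A v ∨ B v
    A⊆C : ∀ v → A v ≡ true → C v ≡ true
    A⊆C v Av rewrite Av = refl
    B⊆C : ∀ v → B v ≡ true → C v ≡ true
    B⊆C v Bv rewrite Bv = BoolP.∨-zeroʳ (A v)
    outside-C : ∀ {v} → A v ≡ false → B v ≡ false → C v ≡ false
    outside-C Av Bv rewrite Av | Bv = refl
    C-effective : Effective G (E -Δ 𝟙 C)
    C-effective v = bool-cases (A v)
      (λ Av → ℤP.≤-trans (LegalFiring.fired-effective legalA v) (fire-superset-≥ E A C A⊆C Av))
      (λ Av → bool-cases (B v)
        (λ Bv → ℤP.≤-trans (LegalFiring.fired-effective legalB v) (fire-superset-≥ E B C B⊆C Bv))
        (λ Bv → ℤP.≤-trans (LegalFiring.effective legalA v) (fire-outside-≥ E C (outside-C Av Bv))))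
    legalC : LegalFiring E C
    legalC = record
      { inClass = LegalFiring.inClass legalA ; effective = LegalFiring.effective legalA
      ; fired-effective = C-effective
      ; inside = LegalFiring.inside legalA ; inside∈ = A⊆C _ (LegalFiring.inside∈ legalA)
      ; outside = w ; outside∉ = outside-C Aw Bw }

module Construction (G : Graph) (D : Divisor G)
                    (positive : PositiveRank G D) (partitions : Partitions G D) where

  open Partition G D positive partitions public

  root : V
  root = rep v₀

  rep-root : rep root ≡ root
  rep-root = rep-idem v₀

  representatives-equal : ∀ {x y} → rep x ≡ x → rep y ≡ y → D⁺ x ≗ D⁺ y → x ≡ y
  representatives-equal {x} {y} rx ry x≗y = trans (sym rx) (trans (rep-cong x≗y) ry)

  relPotential : V → V → V → ℤ
  relPotential x y w = potential y w - potential x w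

  D⁺≗-relPotential : ∀ x y → D⁺ y ≗ D⁺ x -Δ relPotential x y
  D⁺≗-relPotential x y w = begin
    D⁺ y w
      ≡⟨ D⁺≗D-Δpotential y w ⟩
    D w - Δ (potential y) w
      ≡⟨ regroup (D w) (Δ (potential y) w) (Δ (potential x) w) ⟩
    (D w - Δ (potential x) w) - (Δ (potential y) w - Δ (potential x) w)
      ≡⟨ cong₂ _-_ (sym (D⁺≗D-Δpotential x w)) (sym (Δ-minus (potential y) (potential x) w)) ⟩
    D⁺ x w - Δ (relPotential x y) w
      ∎
    where
    open ≡-Reasoning
    regroup : ∀ a b c → a - b ≡ (a - c) - (b - c)
    regroup = solve-∀

  height : V → V → ℤ
  height x = relPotential x root

  height-root : ∀ w → height root w ≡ + 0
  height-root w = ℤP.+-inverseʳ (potential root w)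

  firingSet : V → V → Bool
  firingSet x = maxSet (height x)

  firingSet-root : ∀ w → firingSet root w ≡ true
  firingSet-root w = maxSet-complete (height root) (trans (height-root w) (sym (height-root (argmax (height root)))))

  fired : V → Divisor G
  fired x = D⁺ x -Δ 𝟙 (firingSet x)

  firingSet-legal : ∀ {x} → rep x ≡ x → ¬ x ≡ root → LegalFiring (D⁺ x) (firingSet x)
  firingSet-legal {x} rx x≢root = maxSet-legal (height x) (D⁺-class x) (D⁺-effective x) (D⁺-effective root)
    (D⁺≗-relPotential x root) (λ root≗x → x≢root (representatives-equal rx rep-root (λ w → sym (root≗x w))))

  height-step : ∀ {x y} A → D⁺ y ≗ D⁺ x -Δ 𝟙 A → ∃ λ K → ∀ w → height y w ≡ height x w - 𝟙 A w - K
  height-step {x} {y} A y≗ =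
    proj₁ shift , λ w → isolate (height y w) (𝟙 A w) (height x w) (proj₁ shift) (proj₂ shift w)
    where
    both : D⁺ x -Δ height x ≗ D⁺ x -Δ (λ w → 𝟙 A w + height y w)
    both w = begin
      D⁺ x w - Δ (height x) w                 ≡⟨ D⁺≗-relPotential x root w ⟨
      D⁺ root w                               ≡⟨ D⁺≗-relPotential y root w ⟩
      D⁺ y w - Δ (height y) w                 ≡⟨ cong (λ a → a - Δ (height y) w) (y≗ w) ⟩
      (D⁺ x w - Δ (𝟙 A) w) - Δ (height y) w   ≡⟨ -Δ-+ (D⁺ x) (𝟙 A) (height y) w ⟩
      D⁺ x w - Δ (λ w → 𝟙 A w + height y w) w ∎
      where open ≡-Reasoning
    shift : ∃ λ K → ∀ w → 𝟙 A w + height y w ≡ height x w - K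
    shift = same-Δ⇒shift (height x) (λ w → 𝟙 A w + height y w)
      (-Δ-injective (D⁺ x) (height x) (λ w → 𝟙 A w + height y w) both)
    isolate : ∀ a i b K → i + a ≡ b - K → a ≡ b - i - K
    isolate a i b K eq = trans (cancel a i) (trans (cong (_- i) eq) (swap b K i))
      where
      cancel : ∀ a i → a ≡ i + a - i
      cancel = solve-∀
      swap : ∀ b K i → b - K - i ≡ b - i - K
      swap = solve-∀

  firstPositive : Divisor G → V
  firstPositive F = fromMaybe v₀ (first (positive? ∘ F))

  firstPositive-positive : ∀ F {z} → + 1 ≤ F z → + 1 ≤ F (firstPositive F)
  firstPositive-positive F {z} Fz>0 with first-complete (positive? ∘ F) z (positive?-complete Fz>0)
  ... | j , first≡j , Fj>0 rewrite first≡j = positive?-sound Fj>0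

  fired-positive : ∀ {x} → rep x ≡ x → ¬ x ≡ root → ∃ λ z → + 1 ≤ fired x z
  fired-positive {x} rx x≢root =
    across (crossing (firingSet x) (LegalFiring.inside∈ legal) (LegalFiring.outside∉ legal))
    where
    legal : LegalFiring (D⁺ x) (firingSet x)
    legal = firingSet-legal rx x≢root
    across : (∃ λ a → ∃ λ z → firingSet x a ≡ true × firingSet x z ≡ false × 1 ℕ.≤ mult G a z) →
      ∃ λ z → + 1 ≤ fired x z
    across (a , z , az , zf , az-edge) = z , fire-across-edge (D⁺ x) (firingSet x) az zf az-edge (D⁺-effective x z)

  parent : V → V
  parent x with rep x ≟ x | x ≟ root
  ... | no _  | _     = rep x
  ... | yes _ | yes _ = root
  ... | yes _ | no _  = rep (firstPositive (fired x))

  parent-nonrep : ∀ {x} → ¬ rep x ≡ x → parent x ≡ rep x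
  parent-nonrep {x} rx≢x with rep x ≟ x | x ≟ root
  ... | yes rx | _ = ⊥-elim (rx≢x rx)
  ... | no _   | _ = refl

  parent-root : parent root ≡ root
  parent-root with rep root ≟ root | root ≟ root
  ... | no r≢r | _       = ⊥-elim (r≢r rep-root)
  ... | yes _  | yes _   = refl
  ... | yes _  | no r≢r  = ⊥-elim (r≢r refl)

  parent-rep : ∀ {x} → rep x ≡ x → ¬ x ≡ root → parent x ≡ rep (firstPositive (fired x))
  parent-rep {x} rx x≢root with rep x ≟ x | x ≟ root
  ... | no rx≢x | _          = ⊥-elim (rx≢x rx)
  ... | yes _   | yes x≡root = ⊥-elim (x≢root x≡root)
  ... | yes _   | no _       = refl

  parent-isRep : ∀ x → rep (parent x) ≡ parent x
  parent-isRep x with rep x ≟ x | x ≟ root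
  ... | no _  | _     = rep-idem x
  ... | yes _ | yes _ = rep-root
  ... | yes _ | no _  = rep-idem (firstPositive (fired x))

  D⁺-parent : ∀ {x} → rep x ≡ x → ¬ x ≡ root → D⁺ (parent x) ≗ fired x
  D⁺-parent {x} rx x≢root w = trans (cong (λ p → D⁺ p w) (parent-rep rx x≢root))
    (D⁺-rep-unique (LegalFiringProperties.fired-inClass legal) (LegalFiring.fired-effective legal)
      (firstPositive (fired x)) (firstPositive-positive (fired x) (proj₂ (fired-positive rx x≢root))) w)
    where
    legal : LegalFiring (D⁺ x) (firingSet x)
    legal = firingSet-legal rx x≢root

  parent≡ : ∀ {x y} → rep y ≡ y → D⁺ (parent x) ≗ D⁺ y → parent x ≡ y
  parent≡ {x} ry px≗y = representatives-equal (parent-isRep x) ry px≗y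

  -- A vertex that is not a representative hangs directly below its representative, whence
  -- the doubled ranges.
  depth : V → ℕ
  depth x with rep x ≟ x
  ... | yes _ = 2 ℕ.* range (height x)
  ... | no _  = suc (2 ℕ.* range (height (rep x)))

  depth-rep : ∀ {x} → rep x ≡ x → depth x ≡ 2 ℕ.* range (height x)
  depth-rep {x} rx with rep x ≟ x
  ... | yes _   = refl
  ... | no rx≢x = ⊥-elim (rx≢x rx)

  depth-nonrep : ∀ {x} → ¬ rep x ≡ x → depth x ≡ suc (2 ℕ.* range (height (rep x)))
  depth-nonrep {x} rx≢x with rep x ≟ x
  ... | yes rx = ⊥-elim (rx≢x rx)
  ... | no _   = refl

  depth-parent : ∀ {x} → ¬ x ≡ root → depth (parent x) ℕ.< depth x
  depth-parent {x} x≢root = byCase (rep x ≟ x)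
    where
    byCase : Dec (rep x ≡ x) → depth (parent x) ℕ.< depth x
    byCase (no rx≢x) = subst₂ ℕ._<_ (sym (trans (cong depth (parent-nonrep rx≢x)) (depth-rep (rep-idem x))))
                         (sym (depth-nonrep rx≢x)) (ℕP.n<1+n _)
    byCase (yes rx) = subst₂ ℕ._<_ (sym (depth-rep (parent-isRep x))) (sym (depth-rep rx))
      (ℕP.*-monoʳ-< 2 (range-decreases (height x) (height (parent x)) (proj₁ step) (proj₂ step)
        (LegalFiring.outside∉ (firingSet-legal rx x≢root))))
      where
      step : ∃ λ K → ∀ w → height (parent x) w ≡ height x w - 𝟙 (firingSet x) w - K
      step = height-step (firingSet x) (D⁺-parent rx x≢root)

  -- Firing from D⁺ U the set B where the potential from D⁺ U to D⁺ W is maximal gives D⁺ W.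
  -- Either B is the firing set of U, so W is the parent of U; or, by legal-unique, the
  -- complement of B lies in the firing set of U, so the complement of B is the firing set of
  -- W, firing it from D⁺ W gives back D⁺ U, and U is the parent of W.
  module EdgeBetweenClasses {u v} (uv : 1 ℕ.≤ mult G u v) (U≢W : ¬ rep u ≡ rep v) where

    U W : V
    U = rep u
    W = rep v

    B : V → Bool
    B = maxSet (relPotential U W)

    W≉U : ¬ (D⁺ W ≗ D⁺ U)
    W≉U W≗U = U≢W (representatives-equal (rep-idem u) (rep-idem v) (λ w → sym (W≗U w)))

    legalB : LegalFiring (D⁺ U) B
    legalB = maxSet-legal (relPotential U W) (D⁺-class U) (D⁺-effective U) (D⁺-effective W)
      (D⁺≗-relPotential U W) W≉U

    open LegalFiringProperties legalB

    u∈B : B u ≡ true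
    u∈B = positive⇒inside (D⁺-rep-positive u)

    v∉B : B v ≡ false
    v∉B = bool-cases (B v) (λ v∈B → ⊥-elim (v∉B′ v∈B v∈B′)) id
      where
      legalB′ : LegalFiring (D⁺ W) (maxSet (relPotential W U))
      legalB′ = maxSet-legal (relPotential W U) (D⁺-class W) (D⁺-effective W) (D⁺-effective U)
        (D⁺≗-relPotential W U) (λ U≗W → W≉U (λ w → sym (U≗W w)))
      v∈B′ : maxSet (relPotential W U) v ≡ true
      v∈B′ = LegalFiringProperties.positive⇒inside legalB′ (D⁺-rep-positive v)
      antisymmetric : ∀ w → relPotential W U w ≡ - relPotential U W w
      antisymmetric w = flip (potential U w) (potential W w)
        where
        flip : ∀ a b → a - b ≡ - (b - a)
        flip = solve-∀
      v∉B′ : B v ≡ true → maxSet (relPotential W U) v ≡ true → ⊥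
      v∉B′ v∈B v∈B′ = true≢false (trans (sym v∈B′) (not-maxSet-of-negation (relPotential U W) (relPotential W U)
        antisymmetric {LegalFiring.outside legalB} {v} (LegalFiring.outside∉ legalB) v∈B))

    W≗fired : D⁺ W ≗ D⁺ U -Δ 𝟙 B
    W≗fired = D⁺-rep-unique fired-inClass (LegalFiring.fired-effective legalB) v
      (fire-across-edge (D⁺ U) B u∈B v∉B uv (D⁺-effective U v))

    parent-U : ¬ U ≡ root → (∀ w → B w ≡ firingSet U w) → parent U ≡ W
    parent-U U≢root B≗ = parent≡ (rep-idem v) λ w → trans (D⁺-parent (rep-idem u) U≢root w)
      (trans (cong (_-_ (D⁺ U w)) (Δ-cong (λ z → cong (λ b → if b then + 1 else + 0) (sym (B≗ z))) w))
             (sym (W≗fired w)))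

    parent-W : ¬ W ≡ root → (∀ w → B w ≡ false → firingSet U w ≡ true) → parent W ≡ U
    parent-W W≢root outside-B⊆ = parent≡ (rep-idem u) λ w → begin
      D⁺ (parent W) w                           ≡⟨ D⁺-parent (rep-idem v) W≢root w ⟩
      D⁺ W w - Δ (𝟙 (firingSet W)) w            ≡⟨ cong (_-_ (D⁺ W w)) (Δ-cong complement w) ⟩
      D⁺ W w - Δ (𝟙 (not ∘ B)) w                ≡⟨ cong (λ a → a - Δ (𝟙 (not ∘ B)) w) (W≗fired w) ⟩
      ((D⁺ U -Δ 𝟙 B) -Δ 𝟙 (not ∘ B)) w          ≡⟨ fire-complement (D⁺ U) B w ⟩
      D⁺ U w                                    ∎
      where
      open ≡-Reasoning
      step : ∃ λ K → ∀ w → height W w ≡ height U w - 𝟙 B w - K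
      step = height-step B W≗fired
      complement : ∀ z → 𝟙 (firingSet W) z ≡ 𝟙 (not ∘ B) z
      complement z = cong (λ b → if b then + 1 else + 0)
        (maxSet-after-firing (height U) (height W) B (proj₁ step) (proj₂ step) outside-B⊆
          (LegalFiring.outside∉ legalB) z)

    neighbours : parent U ≡ W ⊎ parent W ≡ U
    neighbours = byCases (U ≟ root) (FinP.all? (λ w → B w Bool.≟ firingSet U w))
      where
      byCases : Dec (U ≡ root) → Dec (∀ w → B w ≡ firingSet U w) → parent U ≡ W ⊎ parent W ≡ U
      byCases (no U≢root) (yes B≗) = inj₁ (parent-U U≢root B≗)
      byCases (no U≢root) (no B≉) = inj₂ (parent-W W≢root outside-B⊆)
        where
        W≢root : ¬ W ≡ root
        W≢root W≡root = B≉ (λ w → cong (λ y → maxSet (relPotential U y) w) W≡root)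
        outside-B⊆ : ∀ w → B w ≡ false → firingSet U w ≡ true
        outside-B⊆ w Bw = bool-cases (firingSet U w) id
          (λ Uw → ⊥-elim (B≉ (legal-unique legalB (firingSet-legal (rep-idem u) U≢root) Bw Uw)))
      byCases (yes U≡root) _ = inj₂ (parent-W W≢root outside-B⊆)
        where
        W≢root : ¬ W ≡ root
        W≢root W≡root = U≢W (trans U≡root (sym W≡root))
        outside-B⊆ : ∀ w → B w ≡ false → firingSet U w ≡ true
        outside-B⊆ w _ = subst (λ y → firingSet y w ≡ true) (sym U≡root) (firingSet-root w)

  edge-between-classes : ∀ {u v} → 1 ℕ.≤ mult G u v → ¬ rep u ≡ rep v →
    parent (rep u) ≡ rep v ⊎ parent (rep v) ≡ rep u
  edge-between-classes uv U≢W = EdgeBetweenClasses.neighbours uv U≢W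

module Decomposition (G : Graph) (D : Divisor G)
                     (positive : PositiveRank G D) (partitions : Partitions G D) where

  open Construction G D positive partitions
  open ParentPointerTree (nonempty G) parent root parent-root depth depth-parent
    using (parentTree; linked; linked⁺; linked⁻; Edge-sym)

  -- The nodes of the tree are the vertices of G; only representatives have nonempty bags.
  decomposition : TreeCutDecomposition G
  decomposition = record { tree = parentTree ; bag = rep }

  edge-classes : ∀ {u v} → 1 ℕ.≤ mult G u v → rep u ≡ rep v ⊎ T (linked (rep u) (rep v))
  edge-classes {u} {v} uv = byCase (rep u ≟ rep v)
    where
    byCase : Dec (rep u ≡ rep v) → rep u ≡ rep v ⊎ T (linked (rep u) (rep v))
    byCase (yes U≡W) = inj₁ U≡W
    byCase (no U≢W) with edge-between-classes uv U≢W
    ... | inj₁ pU≡W = inj₂ (linked⁺ pU≡W U≢W)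
    ... | inj₂ pW≡U = inj₂ (Edge-sym (linked⁺ pW≡U (U≢W ∘ sym)))

  reach-edge : ∀ (adj′ : V → V → Bool) {a b} → T (adj′ a b) → T (reachB adj′ (n G) a b)
  reach-edge adj′ {a} {b} e =
    Reachability.reach-mono adj′ (nonempty G) {a} {b}
      (Reachability.reach-step adj′ 0 {a} {a} {b} (Reachability.reach-refl adj′ 0 a) e)

  reach-same : ∀ (adj′ : V → V → Bool) {a b} → a ≡ b → T (reachB adj′ (n G) a b)
  reach-same adj′ {a} refl = Reachability.reach-refl adj′ (n G) a

  degree-D⁺ : ∀ x → sum (D⁺ x) ≡ sum D
  degree-D⁺ x = trans (sum-cong-≗ (D⁺≗D-Δpotential x)) (degree-Δ D (potential x))

  bound : ℕ
  bound = ℤ.∣ sum D ∣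

  +bound : + bound ≡ sum D
  +bound = ℤP.0≤i⇒+∣i∣≡i (subst (+ 0 ≤_) (degree-D⁺ v₀) (sum-nonNeg (D⁺-effective v₀)))

  ≤bound : ∀ {k} → + k ≤ sum D → k ℕ.≤ bound
  ≤bound k≤ = ℤP.drop‿+≤+ (subst (_ ≤_) (sym +bound) k≤)

  +sumℕ : ∀ (f : V → ℕ) → + sumℕ f ≡ sum (+_ ∘ f)
  +sumℕ f = trans (cong +_ (sumℕ≡sum f)) (+-sum f)

  bagSize≤ : ∀ b → bagSize decomposition b ℕ.≤ bound
  bagSize≤ b = ≤bound (begin
    + bagSize decomposition b                        ≡⟨ +sumℕ (λ v → if eqB (rep v) b then 1 else 0) ⟩
    sum (λ v → + (if eqB (rep v) b then 1 else 0))   ≤⟨ sum-mono-≤ in-bag≤D⁺ ⟩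
    sum (D⁺ b)                                       ≡⟨ degree-D⁺ b ⟩
    sum D                                            ∎)
    where
    open ℤP.≤-Reasoning
    in-bag≤D⁺ : ∀ v → + (if eqB (rep v) b then 1 else 0) ≤ D⁺ b v
    in-bag≤D⁺ v with rep v ≟ b
    ... | yes refl = D⁺-rep-positive v
    ... | no _ = D⁺-effective b v

  adhNode≡0 : ∀ b → adhNode decomposition b ≡ 0
  adhNode≡0 b = pairSum-zero term
    where
    R : V → V → Bool
    R = reachB (adjMinusNode parentTree b) (n G)
    separated : ∀ {u v} → 1 ℕ.≤ mult G u v →
      ¬ T (not (eqB (rep u) b) ∧ not (eqB (rep v) b) ∧ not (R (rep u) (rep v)))
    separated {u} {v} uv cond with Equivalence.to (BoolP.T-∧ {not (eqB (rep u) b)}) cond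
    ... | U≢b , rest with Equivalence.to (BoolP.T-∧ {not (eqB (rep v) b)}) rest
    ...   | W≢b , ¬R = T-not⇒¬T ¬R (joined (edge-classes uv))
      where
      joined : rep u ≡ rep v ⊎ T (linked (rep u) (rep v)) → T (R (rep u) (rep v))
      joined (inj₁ U≡W) = reach-same _ U≡W
      joined (inj₂ UW) =
        reach-edge _ (Equivalence.from BoolP.T-∧ (UW , Equivalence.from BoolP.T-∧ (U≢b , W≢b)))
    term : ∀ u v →
      (if not (eqB (rep u) b) ∧ not (eqB (rep v) b) ∧ not (R (rep u) (rep v)) then mult G u v else 0) ≡ 0
    term u v with 1 ℕ.≤? mult G u v
    ... | yes uv = if-¬T _ (separated uv)
    ... | no ¬uv = ℕP.n≤0⇒n≡0 (ℕP.≤-trans (if-≤ _ _) (ℕP.≤-reflexive (¬1≤n⇒n≡0 ¬uv)))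

  module LinkAdhesion (a b x : V) (x≢px : ¬ x ≡ parent x)
                      (endpoints : ∀ p q → T ((eqB p a ∧ eqB q b) ∨ (eqB p b ∧ eqB q a)) →
                                   (p ≡ x × q ≡ parent x) ⊎ (p ≡ parent x × q ≡ x)) where

    x≢root : ¬ x ≡ root
    x≢root x≡root = x≢px (trans x≡root (sym (trans (cong parent x≡root) parent-root)))

    rep-x : ∀ {u} → rep u ≡ x → rep x ≡ x
    rep-x {u} U≡x = trans (cong rep (sym U≡x)) (trans (rep-idem u) U≡x)

    childToParent : V → V → ℕ
    childToParent u v = if eqB (rep u) x ∧ eqB (rep v) (parent x) then mult G u v else 0

    childToParent-edge : ∀ {u v} → rep u ≡ x → rep v ≡ parent x → childToParent u v ≡ mult G u v
    childToParent-edge {u} {v} U≡x W≡px = cong (λ c → if c then mult G u v else 0)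
      (cong₂ _∧_ (dec-true (rep u ≟ x) U≡x) (dec-true (rep v ≟ parent x) W≡px))

    childToParent-other : ∀ {u v} → ¬ rep u ≡ x ⊎ ¬ rep v ≡ parent x → childToParent u v ≡ 0
    childToParent-other {u} {v} (inj₁ U≢x) =
      cong (λ c → if c ∧ eqB (rep v) (parent x) then mult G u v else 0) (eqB-≢ U≢x)
    childToParent-other {u} {v} (inj₂ W≢px) =
      cong (λ c → if c then mult G u v else 0)
        (trans (cong (eqB (rep u) x ∧_) (eqB-≢ W≢px)) (BoolP.∧-zeroʳ (eqB (rep u) x)))

    R : V → V → Bool
    R = reachB (adjMinusLink parentTree a b) (n G)

    cut-edge : ∀ u v →
      (if not (R (rep u) (rep v)) then mult G u v else 0) ℕ.≤ childToParent u v ℕ.+ childToParent v u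
    cut-edge u v with 1 ℕ.≤? mult G u v
    ... | no ¬uv = ℕP.≤-trans (if-≤ _ _) (ℕP.≤-trans (ℕP.≤-reflexive (¬1≤n⇒n≡0 ¬uv)) z≤n)
    ... | yes uv with edge-classes uv
    ...   | inj₁ U≡W =
      ℕP.≤-trans (ℕP.≤-reflexive (if-¬T _ (λ ¬R → T-not⇒¬T ¬R (reach-same _ U≡W)))) z≤n
    ...   | inj₂ UW with T? ((eqB (rep u) a ∧ eqB (rep v) b) ∨ (eqB (rep u) b ∧ eqB (rep v) a))
    ...     | no ¬cut = ℕP.≤-trans (ℕP.≤-reflexive (if-¬T _ (λ ¬R → T-not⇒¬T ¬R
                          (reach-edge _ (Equivalence.from BoolP.T-∧ (UW , ¬T⇒T-not ¬cut)))))) z≤n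
    ...     | yes cut with endpoints (rep u) (rep v) cut
    ...       | inj₁ (U≡x , W≡px) = ℕP.≤-trans (if-≤ _ _)
                  (subst (λ m → mult G u v ℕ.≤ m ℕ.+ childToParent v u) (sym (childToParent-edge U≡x W≡px))
                    (ℕP.m≤m+n (mult G u v) (childToParent v u)))
    ...       | inj₂ (U≡px , W≡x) = ℕP.≤-trans (if-≤ _ _)
                  (subst (λ m → mult G u v ℕ.≤ childToParent u v ℕ.+ m)
                    (sym (trans (childToParent-edge W≡x U≡px) (mult-sym G v u)))
                    (ℕP.m≤n+m (mult G u v) (childToParent u v)))

    row≤D⁺ : ∀ u → + ℕΣ.sum (childToParent u) ≤ D⁺ x u
    row≤D⁺ u = byCase (rep u ≟ x)
      where
      byCase : Dec (rep u ≡ x) → + ℕΣ.sum (childToParent u) ≤ D⁺ x u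
      byCase (no U≢x) =
        subst (λ s → + s ≤ D⁺ x u) (sym (ℕsum-zero {f = childToParent u} (λ v → childToParent-other (inj₁ U≢x))))
          (D⁺-effective x u)
      byCase (yes U≡x) = begin
        + ℕΣ.sum (childToParent u)          ≡⟨ +-sum (childToParent u) ⟩
        sum (λ v → + childToParent u v)     ≤⟨ sum-mono-≤ term ⟩
        edgesOutOf (firingSet x) u          ≡⟨ ≡edgesOutOf-inside u∈S ⟨
        D⁺ x u                              ∎
        where
        open ℤP.≤-Reasoning
        rx : rep x ≡ x
        rx = rep-x U≡x
        legal : LegalFiring (D⁺ x) (firingSet x)
        legal = firingSet-legal rx x≢root
        open LegalFiringProperties legal
        u∈S : firingSet x u ≡ true
        u∈S = positive⇒inside (subst (λ y → + 1 ≤ D⁺ y u) U≡x (D⁺-rep-positive u))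
        term : ∀ v → + childToParent u v ≤ μ u v * (+ 1 - 𝟙 (firingSet x) v)
        term v = byRep (rep v ≟ parent x)
          where
          byRep : Dec (rep v ≡ parent x) → + childToParent u v ≤ μ u v * (+ 1 - 𝟙 (firingSet x) v)
          byRep (no W≢px) = subst (_≤ μ u v * (+ 1 - 𝟙 (firingSet x) v))
            (cong +_ (sym (childToParent-other (inj₂ W≢px)))) (edgeOutOf-nonNeg (firingSet x) u v)
          byRep (yes W≡px) = ℤP.≤-reflexive (begin-equality
            + childToParent u v                  ≡⟨ cong +_ (childToParent-edge U≡x W≡px) ⟩
            μ u v                                ≡⟨ ℤP.*-identityʳ (μ u v) ⟨
            μ u v * (+ 1 - + 0)                  ≡⟨ cong (λ i → μ u v * (+ 1 - i)) (𝟙-false (firingSet x) v∉S) ⟨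
            μ u v * (+ 1 - 𝟙 (firingSet x) v)    ∎)
            where
            v∉S : firingSet x v ≡ false
            v∉S = fired-positive⇒outside (subst (+ 1 ≤_) (D⁺-parent rx x≢root v)
                    (subst (λ y → + 1 ≤ D⁺ y v) W≡px (D⁺-rep-positive v)))

    adhLink≤ : adhLink decomposition a b ℕ.≤ bound
    adhLink≤ = ℕP.≤-trans (pairSum-mono cut-edge) (ℕP.≤-trans (pairSum-symmetrised childToParent) (≤bound total))
      where
      open ℤP.≤-Reasoning
      total : + ℕΣ.sum (λ u → ℕΣ.sum (childToParent u)) ≤ sum D
      total = begin
        + ℕΣ.sum (λ u → ℕΣ.sum (childToParent u))   ≡⟨ +-sum (λ u → ℕΣ.sum (childToParent u)) ⟩
        sum (λ u → + ℕΣ.sum (childToParent u))      ≤⟨ sum-mono-≤ row≤D⁺ ⟩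
        sum (D⁺ x)                                  ≡⟨ degree-D⁺ x ⟩
        sum D                                       ∎

  link≤ : ∀ a b → (if linked a b then adhLink decomposition a b else 0) ℕ.≤ bound
  link≤ a b = if-T-≤ (linked a b) λ ab → byLink (linked⁻ ab)
    where
    byLink : ¬ a ≡ b × (parent a ≡ b ⊎ parent b ≡ a) → adhLink decomposition a b ℕ.≤ bound
    byLink (a≢b , inj₁ refl) = LinkAdhesion.adhLink≤ a b a a≢b (link-endpoints a b)
    byLink (a≢b , inj₂ refl) =
      LinkAdhesion.adhLink≤ a b b (a≢b ∘ sym) (λ p q → Sum.swap ∘ link-endpoints a b p q)

  node≤ : ∀ b → bagSize decomposition b ℕ.+ adhNode decomposition b ℕ.≤ bound
  node≤ b = subst (ℕ._≤ bound)
    (sym (trans (cong (bagSize decomposition b ℕ.+_) (adhNode≡0 b)) (ℕP.+-identityʳ (bagSize decomposition b))))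
    (bagSize≤ b)

  width≤deg : + width decomposition ≤ deg G D
  width≤deg = subst (+ width decomposition ≤_) (trans +bound (sym (sumℤ≡sum D)))
    (+≤+ (ℕP.⊔-lub (maxℕ-lub _ (λ a → maxℕ-lub _ (link≤ a))) (maxℕ-lub _ node≤)))

mainTheorem3 : (G : Graph) (D : Divisor G) → PositiveRank G D → Partitions G D →
    (Σ (TreeCutDecomposition G) λ 𝒯 → + width 𝒯 ℤ.≤ deg G D)
    × (∀ g → IsGonality G g → deg G D ≡ g →
         Σ (TreeCutDecomposition G) λ 𝒯 → + width 𝒯 ℤ.≤ g)
mainTheorem3 G D positive partitions =
  (decomposition , width≤deg) ,
  λ g _ deg≡g → decomposition , subst (+ width decomposition ≤_) deg≡g width≤deg
  where
  open Decomposition G D positive partitions
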